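{- Let $w=[k_0,\dots,k_{r-1},\overline{a_0,\dots,a_{2n-1}}]$ be a real quadratic irrational, where $k_0\in\mathbb{Z}$, $k_1,\dots,k_{r-1},a_0,\dots,a_{2n-1}$ are positive integers, and $k_{r-1}\ne a_{2n-1}$ (when $r\ge1$). Then its Galois conjugate $w'$ has the continued fraction expansion \[ w'=\begin{cases} [-1,1,a_{2n-1}-1,\overline{a_{2n-2},\dots,a_0,a_{2n-1}}] & \text{if } r=0,\\ [k_0-a_{2n-1}-1,1,a_{2n-2}-1,\overline{a_{2n-3},\dots,a_0,a_{2n-1},a_{2n-2}}] & \text{if } r=1,\\ [k_0,\dots,k_{r-2},k_{r-1}-a_{2n-1}-1,1,a_{2n-2}-1,\overline{a_{2n-3},\dots,a_0,a_{2n-1},a_{2n-2}}] & \text{if } r\ge2,\ k_{r-1}>a_{2n-1},\\ [k_0,\dots,k_{r-3},k_{r-2}-1,1,a_{2n-1}-k_{r-1}-1,\overline{a_{2n-2},\dots,a_0,a_{2n-1}}] & \text{if } r\ge2,\ 0<k_{r-1}<a_{2n-1}, \end{cases} \] where, whenever an inner entry equals $0$, one uses the convention $[\dots,a,0,b,\dots]=[\dots,a+b,\dots]$.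
   Context: $[c_0,c_1,c_2,\dots]=c_0+1/(c_1+1/(c_2+\cdots))$ denotes a continued fraction, and $[k_0,\dots,k_{r-1},\overline{a_0,\dots,a_{t-1}}]$ the eventually periodic one with preperiod $k_0,\dots,k_{r-1}$ and period $a_0,\dots,a_{t-1}$. The Galois conjugate $w'$ of a real quadratic irrational $w$ is its conjugate under the nontrivial automorphism of $\mathbb{Q}(w)$. -}

module Defs where

open import Data.Nat using (ℕ; zero; suc; _%_)
open import Data.Integer as ℤ using (ℤ; +_)
open import Data.Rational as ℚ using (ℚ; _/_; 0ℚ; 1ℚ)
open import Data.List using (List; []; _∷_; length)
open import Data.Product using (Σ; _×_)
open import Data.Sum using (_⊎_)
open import Relation.Binary.PropositionalEquality using (_≡_)
open import Relation.Nullary using (¬_)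

-- The real quadratic field Q(√D), D a natural number (D nonsquare in use).
-- An element a + b√D is the pair (re , im) = (a , b) of rationals,
-- viewed as the real number a + b·√D (√D ≥ 0).

record QD : Set where
  constructor _+√_
  field
    re : ℚ
    im : ℚ
open QD public

NonSquare : ℕ → Set
NonSquare D = ∀ (m : ℕ) → ¬ (Data.Nat._*_ m m ≡ D)

fromℤQ : ℤ → QD
fromℤQ z = (z / 1) +√ 0ℚ

oneQ : QD
oneQ = 1ℚ +√ 0ℚ

zeroQ : QD
zeroQ = 0ℚ +√ 0ℚ

infixl 6 _⊖_
_⊖_ : QD → QD → QD
(a +√ b) ⊖ (c +√ d) = (a ℚ.- c) +√ (b ℚ.- d)

mulQ : ℕ → QD → QD → QD
mulQ D (a +√ b) (c +√ d) =
  ((a ℚ.* c) ℚ.+ ((b ℚ.* d) ℚ.* ((+ D) / 1))) +√ ((a ℚ.* d) ℚ.+ (b ℚ.* c))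

conjQ : QD → QD
conjQ (a +√ b) = a +√ (ℚ.- b)

NonNegQ : ℕ → QD → Set
NonNegQ D (a +√ b) =
    (0ℚ ℚ.≤ a × 0ℚ ℚ.≤ b)
  ⊎ (0ℚ ℚ.≤ a × b ℚ.< 0ℚ × (b ℚ.* b) ℚ.* ((+ D) / 1) ℚ.≤ a ℚ.* a)
  ⊎ (a ℚ.< 0ℚ × 0ℚ ℚ.≤ b × a ℚ.* a ℚ.≤ (b ℚ.* b) ℚ.* ((+ D) / 1))

LeQ : ℕ → QD → QD → Set
LeQ D x y = NonNegQ D (y ⊖ x)

LtQ : ℕ → QD → QD → Set
LtQ D x y = NonNegQ D (y ⊖ x) × ¬ (y ⊖ x ≡ zeroQ)

-- IsCF D w c : the (simple) continued fraction expansion of the real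
-- number w ∈ Q(√D) is w = [c 0 , c 1 , c 2 , …], i.e. there are complete
-- quotients x i with x 0 = w, c i = ⌊x i⌋ and x (i+1) = 1 / (x i - c i).

IsCF : ℕ → QD → (ℕ → ℤ) → Set
IsCF D w c =
  Σ (ℕ → QD) λ x →
    (x 0 ≡ w) ×
    (∀ i → LeQ D (fromℤQ (c i)) (x i)
         × LtQ D (x i) (fromℤQ (c i ℤ.+ + 1))
         × (mulQ D (x (suc i)) (x i ⊖ fromℤQ (c i)) ≡ oneQ))

nthOr : ℤ → List ℤ → ℕ → ℤ
nthOr d [] _ = d
nthOr d (x ∷ xs) zero = x
nthOr d (x ∷ xs) (suc i) = nthOr d xs i

periodic : List ℤ → ℕ → ℤ
periodic [] _ = + 0
periodic (x ∷ xs) i = nthOr x (x ∷ xs) (i % suc (length xs))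

evp : List ℤ → List ℤ → ℕ → ℤ
evp [] per i = periodic per i
evp (k ∷ ks) per zero = k
evp (k ∷ ks) per (suc i) = evp ks per i

-- The convention [… , a , 0 , b , …] = [… , a + b , …] for inner zeros
-- (applied repeatedly, left to right; the first entry is never merged away).

mergeGo : ℤ → List ℤ → List ℤ
mergeGo x [] = x ∷ []
mergeGo x (+ zero ∷ y ∷ rest) = mergeGo (x ℤ.+ y) rest
mergeGo x (z ∷ rest) = x ∷ mergeGo z rest

mergeZeros : List ℤ → List ℤ
mergeZeros [] = []
mergeZeros (x ∷ xs) = mergeGo x xs

-- All zero entries
-- occur in pre (period entries are positive), so normalising pre ++ per
-- (one copy of the period) and then continuing periodically suffices.
cfSeq : List ℤ → List ℤ → ℕ → ℤ
cfSeq pre per = evp (mergeZeros (pre Data.List.++ per)) per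

-- Let y be the complete quotient of w at which the period starts, so w = [pre, y] and
-- y = [a₀, …, a_{2n-1}, y]; the latter needs uniqueness of expansions (the difference of two
-- expansions with the same digits at least doubles every two steps, yet stays below 1).  The
-- relations x = c + 1/x₁ between successive complete quotients are algebraic, so they hold for
-- the conjugates too, and they can be read backwards: -1/x₁ = c + 1/(-1/x).  Hence
-- w₀ = -1/y′ = [a_{2n-1}, …, a₀, w₀], and w₀ > 1 by Galois' theorem -1 < y′ < 0, which holds
-- because y and y′ are both fixed points of the Möbius map of the period, a matrix with
-- positive entries.  Finally -v = c + 1/u with u > 1 gives v = (-c-1) + 1/(1 + 1/(u - 1)); this
-- is applied at the last one or two digits of pre, and zero digits are absorbed by
-- [… , x, 0, y, …] = [… , x + y, …].

module Submission where

open import Defs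
open import Data.Nat as ℕ using (ℕ; zero; suc; _%_; _/_)
open import Data.Nat.DivMod using (m≡m%n+[m/n]*n; [m+n]%n≡m%n; [m+kn]%n≡m%n; m<n⇒m%n≡m; n%n≡0; m%n<n)
import Data.Nat.Properties as ℕ
open import Data.Nat.Divisibility using (_∣_; divides; ∣-refl)
open import Data.Nat.Coprimality as Coprime using (Coprime; coprime-divisor)
open import Data.Integer as ℤ using (ℤ; +_; -[1+_])
import Data.Integer.Properties as ℤ
open import Data.Integer.Tactic.RingSolver using () renaming (solve-∀ to ℤ-solve-∀)
open import Data.Rational as ℚ using (ℚ; mkℚ; 0ℚ; 1ℚ)
import Data.Rational.Properties as ℚ
open import Data.Rational.Unnormalised as ℚᵘ using (mkℚᵘ; *≡*; *≤*)
import Data.Rational.Unnormalised.Properties as ℚᵘ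
open import Data.Product using (Σ; _×_; _,_; proj₁; proj₂)
open import Data.Sum as Sum using (_⊎_; inj₁; inj₂)
open import Data.Empty using (⊥-elim)
open import Data.List using (List; []; _∷_; _++_; reverse; length; last)
open import Data.Maybe.Relation.Unary.All as Maybe using (just; nothing)
open import Data.List.Properties using (++-identityʳ; reverse-++; unfold-reverse; ∷-injective)
open import Data.List.Relation.Unary.All as All using (All; []; _∷_)
open import Data.List.Relation.Unary.All.Properties using (++⁺; ++⁻ˡ; ++⁻ʳ)
open import Function using (_∘_; case_of_; _$_)
open import Relation.Nullary using (¬_; yes; no)
open import Relation.Nullary.Decidable using (dec⇒maybe; map′; _×-dec_)
open import Relation.Binary.Definitions using (DecidableEquality)
open import Relation.Binary.PropositionalEquality
open import Algebra.Bundles using (CommutativeRing)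
open import Algebra.Structures {A = QD} _≡_ using (IsCommutativeRing)
open import Tactic.RingSolver.Core.AlmostCommutativeRing using (AlmostCommutativeRing; fromCommutativeRing)
open import Tactic.RingSolver using (solve-∀)

ℚ-ring : AlmostCommutativeRing _ _
ℚ-ring = fromCommutativeRing ℚ.+-*-commutativeRing (λ x → dec⇒maybe (0ℚ ℚ.≟ x))

ι : ℤ → ℚ
ι z = z ℚ./ 1

toℚᵘ-ι : ∀ z → ℚ.toℚᵘ (ι z) ℚᵘ.≃ mkℚᵘ z 0
toℚᵘ-ι z = ℚ.toℚᵘ-fromℚᵘ (mkℚᵘ z 0)

ι-+ : ∀ x y → ι (x ℤ.+ y) ≡ ι x ℚ.+ ι y
ι-+ x y = ℚ.toℚᵘ-injective (begin-equality
  ℚ.toℚᵘ (ι (x ℤ.+ y))                 ≃⟨ toℚᵘ-ι (x ℤ.+ y) ⟩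
  mkℚᵘ (x ℤ.+ y) 0                     ≃⟨ *≡* (cong (ℤ._* + 1) (law x y)) ⟩
  mkℚᵘ x 0 ℚᵘ.+ mkℚᵘ y 0               ≃⟨ ℚᵘ.+-cong (toℚᵘ-ι x) (toℚᵘ-ι y) ⟨
  ℚ.toℚᵘ (ι x) ℚᵘ.+ ℚ.toℚᵘ (ι y)       ≃⟨ ℚ.toℚᵘ-homo-+ (ι x) (ι y) ⟨
  ℚ.toℚᵘ (ι x ℚ.+ ι y)                 ∎)
  where
  open ℚᵘ.≤-Reasoning
  law : ∀ x y → x ℤ.+ y ≡ x ℤ.* + 1 ℤ.+ y ℤ.* + 1
  law = ℤ-solve-∀

ι-neg : ∀ x → ι (ℤ.- x) ≡ ℚ.- ι x
ι-neg x = ℚ.toℚᵘ-injective (begin-equality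
  ℚ.toℚᵘ (ι (ℤ.- x))    ≃⟨ toℚᵘ-ι (ℤ.- x) ⟩
  ℚᵘ.- mkℚᵘ x 0         ≃⟨ ℚᵘ.-‿cong (toℚᵘ-ι x) ⟨
  ℚᵘ.- ℚ.toℚᵘ (ι x)     ≃⟨ ℚ.toℚᵘ-homo‿- (ι x) ⟨
  ℚ.toℚᵘ (ℚ.- ι x)      ∎)
  where open ℚᵘ.≤-Reasoning

ι-mono-≤ : ∀ {x y} → x ℤ.≤ y → ι x ℚ.≤ ι y
ι-mono-≤ {x} {y} x≤y = ℚ.toℚᵘ-cancel-≤ (begin
  ℚ.toℚᵘ (ι x)  ≃⟨ toℚᵘ-ι x ⟩
  mkℚᵘ x 0      ≤⟨ *≤* (ℤ.*-monoʳ-≤-nonNeg (+ 1) x≤y) ⟩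
  mkℚᵘ y 0      ≃⟨ toℚᵘ-ι y ⟨
  ℚ.toℚᵘ (ι y)  ∎)
  where open ℚᵘ.≤-Reasoning

ι-injective : ∀ {x y} → ι x ≡ ι y → x ≡ y
ι-injective {x} {y} eq with ℚᵘ.≃-trans (ℚᵘ.≃-sym (toℚᵘ-ι x)) (ℚᵘ.≃-trans (ℚ.toℚᵘ-cong eq) (toℚᵘ-ι y))
... | *≡* x*1≡y*1 = trans (sym (ℤ.*-identityʳ x)) (trans x*1≡y*1 (ℤ.*-identityʳ y))

module ℚ-Facts where
  open import Data.Rational using (_≤_; _<_)

  p≤q⇒0≤q-p : ∀ {p q} → p ≤ q → 0ℚ ≤ q ℚ.- p
  p≤q⇒0≤q-p {p} {q} p≤q = subst (_≤ q ℚ.- p) (ℚ.+-inverseʳ p) (ℚ.+-monoˡ-≤ (ℚ.- p) p≤q)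

  0≤q-p⇒p≤q : ∀ {p q} → 0ℚ ≤ q ℚ.- p → p ≤ q
  0≤q-p⇒p≤q {p} {q} 0≤q-p = subst₂ _≤_ (ℚ.+-identityˡ p) (law q p) (ℚ.+-monoˡ-≤ p 0≤q-p)
    where
    law : ∀ q p → q ℚ.- p ℚ.+ p ≡ q
    law = solve-∀ ℚ-ring

  0≤p*q : ∀ {p q} → 0ℚ ≤ p → 0ℚ ≤ q → 0ℚ ≤ p ℚ.* q
  0≤p*q {p} {q} 0≤p 0≤q = subst (_≤ p ℚ.* q) (ℚ.*-zeroˡ q) (ℚ.*-monoʳ-≤-nonNeg q {{ℚ.nonNegative 0≤q}} 0≤p)

  *-mono-≤-nonNeg : ∀ {p q r s} → 0ℚ ≤ p → p ≤ q → 0ℚ ≤ r → r ≤ s → p ℚ.* r ≤ q ℚ.* s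
  *-mono-≤-nonNeg {p} {q} {r} {s} 0≤p p≤q 0≤r r≤s =
    ℚ.≤-trans (ℚ.*-monoʳ-≤-nonNeg r {{ℚ.nonNegative 0≤r}} p≤q)
              (ℚ.*-monoˡ-≤-nonNeg q {{ℚ.nonNegative (ℚ.≤-trans 0≤p p≤q)}} r≤s)

  neg-involutive : ∀ p → ℚ.- (ℚ.- p) ≡ p
  neg-involutive = solve-∀ ℚ-ring

  neg-square : ∀ p → ℚ.- p ℚ.* ℚ.- p ≡ p ℚ.* p
  neg-square = solve-∀ ℚ-ring

  0≤p*p : ∀ p → 0ℚ ≤ p ℚ.* p
  0≤p*p p with ℚ.≤-total 0ℚ p
  ... | inj₁ 0≤p = 0≤p*q 0≤p 0≤p
  ... | inj₂ p≤0 = subst (0ℚ ≤_) (neg-square p) (0≤p*q (ℚ.neg-antimono-≤ p≤0) (ℚ.neg-antimono-≤ p≤0))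

  square-cancel-≤ : ∀ {p q} → 0ℚ ≤ q → p ℚ.* p ≤ q ℚ.* q → p ≤ q
  square-cancel-≤ {p} {q} 0≤q p²≤q² with p ℚ.≤? q
  ... | yes p≤q = p≤q
  ... | no p≰q = ⊥-elim (ℚ.<-irrefl refl (ℚ.≤-<-trans p²≤q² (ℚ.≤-<-trans q²≤pq pq<pp)))
    where
    q<p : q < p
    q<p = ℚ.≰⇒> p≰q
    q²≤pq : q ℚ.* q ≤ p ℚ.* q
    q²≤pq = ℚ.*-monoʳ-≤-nonNeg q {{ℚ.nonNegative 0≤q}} (ℚ.<⇒≤ q<p)
    pq<pp : p ℚ.* q < p ℚ.* p
    pq<pp = ℚ.*-monoʳ-<-pos p {{ℚ.positive (ℚ.≤-<-trans 0≤q q<p)}} q<p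

  p²≤q²⇒0≤q+p : ∀ {p q} → 0ℚ ≤ q → p ℚ.* p ≤ q ℚ.* q → 0ℚ ≤ q ℚ.+ p
  p²≤q²⇒0≤q+p {p} {q} 0≤q p²≤q² =
    subst (0ℚ ≤_) (law q p) (p≤q⇒0≤q-p (square-cancel-≤ 0≤q (subst (_≤ q ℚ.* q) (sym (neg-square p)) p²≤q²)))
    where
    law : ∀ q p → q ℚ.- (ℚ.- p) ≡ q ℚ.+ p
    law = solve-∀ ℚ-ring

  ℚ-archimedean : ∀ p → Σ ℕ λ n → p ≤ ι (+ n)
  ℚ-archimedean p@(mkℚ (+ n) d-1 _) = n , ℚ.toℚᵘ-cancel-≤ (begin
    ℚ.toℚᵘ p       ≤⟨ *≤* (ℤ.*-monoˡ-≤-nonNeg (+ n) (ℤ.+≤+ (ℕ.s≤s ℕ.z≤n))) ⟩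
    mkℚᵘ (+ n) 0   ≃⟨ toℚᵘ-ι (+ n) ⟨
    ℚ.toℚᵘ (ι (+ n)) ∎)
    where open ℚᵘ.≤-Reasoning
  ℚ-archimedean p@(mkℚ -[1+ n ] d-1 _) = 0 , ℚ.<⇒≤ (ℚ.*<* ℤ.-<+)

  -- with the junk value recip 0 = 0
  recip : ℚ → ℚ
  recip p with p ℚ.≟ 0ℚ
  ... | yes _ = 0ℚ
  ... | no p≢0 = ℚ.1/_ p {{ℚ.≢-nonZero p≢0}}

  *-recipʳ : ∀ p → p ≢ 0ℚ → p ℚ.* recip p ≡ 1ℚ
  *-recipʳ p p≢0 with p ℚ.≟ 0ℚ
  ... | yes p≡0 = ⊥-elim (p≢0 p≡0)
  ... | no p≢0 = ℚ.*-inverseʳ p {{ℚ.≢-nonZero p≢0}}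

  p*p≡0⇒p≡0 : ∀ p → p ℚ.* p ≡ 0ℚ → p ≡ 0ℚ
  p*p≡0⇒p≡0 p p²≡0 with p ℚ.≟ 0ℚ
  ... | yes p≡0 = p≡0
  ... | no p≢0 = begin
    p                        ≡⟨ law p (recip p) ⟩
    p ℚ.* p ℚ.* recip p ℚ.+ p ℚ.* (1ℚ ℚ.- p ℚ.* recip p)  ≡⟨ cong₂ (λ s t → s ℚ.* recip p ℚ.+ p ℚ.* (1ℚ ℚ.- t)) p²≡0 (*-recipʳ p p≢0) ⟩
    0ℚ ℚ.* recip p ℚ.+ p ℚ.* (1ℚ ℚ.- 1ℚ)                 ≡⟨ law₀ p (recip p) ⟩
    0ℚ                       ∎
    where
    open ≡-Reasoning
    law : ∀ p r → p ≡ p ℚ.* p ℚ.* r ℚ.+ p ℚ.* (1ℚ ℚ.- p ℚ.* r)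
    law = solve-∀ ℚ-ring
    law₀ : ∀ p r → 0ℚ ℚ.* r ℚ.+ p ℚ.* (1ℚ ℚ.- 1ℚ) ≡ 0ℚ
    law₀ = solve-∀ ℚ-ring

pos⇒1≤ : ∀ {n} → + 0 ℤ.< n → + 1 ℤ.≤ n
pos⇒1≤ (ℤ.+<+ (ℕ.s≤s _)) = ℤ.+≤+ (ℕ.s≤s ℕ.z≤n)

<⇒0≤-1 : ∀ {i j} → i ℤ.< j → + 0 ℤ.≤ j ℤ.- i ℤ.- + 1
<⇒0≤-1 {i} {j} i<j = subst (+ 0 ℤ.≤_) (law i j) (ℤ.i≤j⇒0≤j-i (ℤ.i<j⇒suc[i]≤j i<j))
  where
  law : ∀ i j → j ℤ.- (+ 1 ℤ.+ i) ≡ j ℤ.- i ℤ.- + 1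
  law = ℤ-solve-∀

<⇒1≤- : ∀ {i j} → i ℤ.< j → + 1 ℤ.≤ j ℤ.- i
<⇒1≤- i<j = ℤ.0≤i-j⇒j≤i (<⇒0≤-1 i<j)

suc-%-suc : ∀ i n → suc i % suc n ≡ suc (i % suc n) % suc n
suc-%-suc i n = trans (cong (λ t → suc t % suc n) (m≡m%n+[m/n]*n i (suc n))) ([m+kn]%n≡m%n (suc (i % suc n)) (i / suc n) (suc n))

suc-% : ∀ i n → suc i % suc n ≡ suc (i % suc n) ⊎ (suc i % suc n ≡ 0 × suc (i % suc n) ≡ suc n)
suc-% i n with ℕ.m≤n⇒m<n∨m≡n (m%n<n i (suc n))
... | inj₁ 1+i%n<n = inj₁ (trans (suc-%-suc i n) (m<n⇒m%n≡m 1+i%n<n))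
... | inj₂ 1+i%n≡n = inj₂ (trans (suc-%-suc i n) (trans (cong (_% suc n) 1+i%n≡n) (n%n≡0 (suc n))) , 1+i%n≡n)

All-reverse : ∀ {P : ℤ → Set} {L} → All P L → All P (reverse L)
All-reverse [] = []
All-reverse {P} {x ∷ L} (px ∷ pL) = subst (All P) (sym (unfold-reverse x L)) (++⁺ (All-reverse pL) (px ∷ []))

last-tail : ∀ {P : ℤ → Set} y L → Maybe.All P (last (y ∷ L)) → Maybe.All P (last L)
last-tail y [] _ = nothing
last-tail y (z ∷ L) p = p

last-All : ∀ {P : ℤ → Set} L → All P L → Maybe.All P (last L)
last-All [] [] = nothing
last-All (x ∷ []) (px ∷ []) = just px
last-All (x ∷ y ∷ L) (_ ∷ pyL) = last-All (y ∷ L) pyL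

last-++ : ∀ L {M : List ℤ} → M ≢ [] → last (L ++ M) ≡ last M
last-++ [] _ = refl
last-++ (x ∷ []) {[]} []≢[] = ⊥-elim ([]≢[] refl)
last-++ (x ∷ []) {y ∷ M} _ = refl
last-++ (x ∷ x′ ∷ L) M≢[] = last-++ (x′ ∷ L) M≢[]

++-∷-≢[] : ∀ L {c : ℤ} {M} → L ++ c ∷ M ≢ []
++-∷-≢[] [] ()
++-∷-≢[] (x ∷ L) ()

nthOr-All : ∀ {P : ℤ → Set} {d} L → All P L → P d → ∀ k → P (nthOr d L k)
nthOr-All [] _ pd k = pd
nthOr-All (x ∷ L) (px ∷ _) _ zero = px
nthOr-All (x ∷ L) (_ ∷ pL) pd (suc k) = nthOr-All L pL pd k

periodic-All : ∀ {P : ℤ → Set} {L} → All P L → L ≢ [] → ∀ i → P (periodic L i)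
periodic-All {L = []} _ []≢[] = ⊥-elim ([]≢[] refl)
periodic-All {L = x ∷ L} pL@(px ∷ _) _ i = nthOr-All (x ∷ L) pL px (i % suc (length L))

evp-nthOr : ∀ L per d {i} → i ℕ.< length L → evp L per i ≡ nthOr d L i
evp-nthOr (x ∷ L) per d {zero} _ = refl
evp-nthOr (x ∷ L) per d {suc i} (ℕ.s≤s i<n) = evp-nthOr L per d i<n

evp-++-periodic : ∀ L per j → evp L per (length L ℕ.+ j) ≡ periodic per j
evp-++-periodic [] per j = refl
evp-++-periodic (x ∷ L) per j = evp-++-periodic L per j

periodic-unfold : ∀ per i → periodic per i ≡ evp per per i
periodic-unfold [] i = refl
periodic-unfold per@(x ∷ L) i with i ℕ.<? length per
... | yes i<n = trans (cong (nthOr x per) (m<n⇒m%n≡m i<n)) (sym (evp-nthOr per per x i<n))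
... | no i≮n = begin
  periodic per i                     ≡⟨ cong (periodic per) (sym (ℕ.m+[n∸m]≡n n≤i)) ⟩
  periodic per (n ℕ.+ (i ℕ.∸ n))     ≡⟨ cong (nthOr x per) (trans (cong (_% n) (ℕ.+-comm n (i ℕ.∸ n))) ([m+n]%n≡m%n (i ℕ.∸ n) n)) ⟩
  periodic per (i ℕ.∸ n)             ≡⟨ evp-++-periodic per per (i ℕ.∸ n) ⟨
  evp per per (n ℕ.+ (i ℕ.∸ n))      ≡⟨ cong (evp per per) (ℕ.m+[n∸m]≡n n≤i) ⟩
  evp per per i                      ∎
  where
  open ≡-Reasoning
  n = length per
  n≤i = ℕ.≮⇒≥ i≮n

+√-cong : ∀ {a b c d} → a ≡ c → b ≡ d → a +√ b ≡ c +√ d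
+√-cong refl refl = refl

infix 4 _≟_
_≟_ : DecidableEquality QD
(a +√ b) ≟ (c +√ d) = map′ (λ (e , f) → +√-cong e f) (λ { refl → refl , refl }) ((a ℚ.≟ c) ×-dec (b ℚ.≟ d))

module QuadraticField (D : ℕ) where

  Dℚ : ℚ
  Dℚ = + D ℚ./ 1

  infixl 6 _+_ _-_
  infixl 7 _*_
  infix 8 -_

  _+_ : QD → QD → QD
  (a +√ b) + (c +√ d) = (a ℚ.+ c) +√ (b ℚ.+ d)

  -_ : QD → QD
  - (a +√ b) = (ℚ.- a) +√ (ℚ.- b)

  _-_ : QD → QD → QD
  x - y = x + - y

  -- Agrees with mulQ D (see *≡mulQ); the zero test lets the ring solver evaluate products
  -- of its constants, whose √D-parts vanish, although D is a variable.
  scaleD : ℚ → ℚ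
  scaleD r with r ℚ.≟ 0ℚ
  ... | yes _ = 0ℚ
  ... | no _ = r ℚ.* Dℚ

  _*_ : QD → QD → QD
  (a +√ b) * (c +√ d) = (a ℚ.* c ℚ.+ scaleD (b ℚ.* d)) +√ (a ℚ.* d ℚ.+ b ℚ.* c)

  *≡mulQ : ∀ x y → x * y ≡ mulQ D x y
  *≡mulQ (a +√ b) (c +√ d) = cong (λ e → (a ℚ.* c ℚ.+ e) +√ (a ℚ.* d ℚ.+ b ℚ.* c)) (scaleD≡ (b ℚ.* d))
    where
    scaleD≡ : ∀ r → scaleD r ≡ r ℚ.* Dℚ
    scaleD≡ r with r ℚ.≟ 0ℚ
    ... | yes refl = sym (ℚ.*-zeroˡ Dℚ)
    ... | no _ = refl

  private
    _·_ : QD → QD → QD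
    _·_ = mulQ D

    ·-assoc : ∀ x y z → (x · y) · z ≡ x · (y · z)
    ·-assoc (a +√ b) (c +√ d) (e +√ f) = +√-cong (re-law a b c d e f Dℚ) (im-law a b c d e f Dℚ)
      where
      re-law : ∀ a b c d e f δ → (a ℚ.* c ℚ.+ b ℚ.* d ℚ.* δ) ℚ.* e ℚ.+ (a ℚ.* d ℚ.+ b ℚ.* c) ℚ.* f ℚ.* δ
                                ≡ a ℚ.* (c ℚ.* e ℚ.+ d ℚ.* f ℚ.* δ) ℚ.+ b ℚ.* (c ℚ.* f ℚ.+ d ℚ.* e) ℚ.* δ
      re-law = solve-∀ ℚ-ring
      im-law : ∀ a b c d e f δ → (a ℚ.* c ℚ.+ b ℚ.* d ℚ.* δ) ℚ.* f ℚ.+ (a ℚ.* d ℚ.+ b ℚ.* c) ℚ.* e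
                                ≡ a ℚ.* (c ℚ.* f ℚ.+ d ℚ.* e) ℚ.+ b ℚ.* (c ℚ.* e ℚ.+ d ℚ.* f ℚ.* δ)
      im-law = solve-∀ ℚ-ring

    ·-comm : ∀ x y → x · y ≡ y · x
    ·-comm (a +√ b) (c +√ d) = +√-cong (re-law a b c d Dℚ) (im-law a b c d)
      where
      re-law : ∀ a b c d δ → a ℚ.* c ℚ.+ b ℚ.* d ℚ.* δ ≡ c ℚ.* a ℚ.+ d ℚ.* b ℚ.* δ
      re-law = solve-∀ ℚ-ring
      im-law : ∀ a b c d → a ℚ.* d ℚ.+ b ℚ.* c ≡ c ℚ.* b ℚ.+ d ℚ.* a
      im-law = solve-∀ ℚ-ring

    ·-identityˡ : ∀ x → oneQ · x ≡ x
    ·-identityˡ (a +√ b) = +√-cong (re-law a b Dℚ) (im-law a b)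
      where
      re-law : ∀ a b δ → 1ℚ ℚ.* a ℚ.+ 0ℚ ℚ.* b ℚ.* δ ≡ a
      re-law = solve-∀ ℚ-ring
      im-law : ∀ a b → 1ℚ ℚ.* b ℚ.+ 0ℚ ℚ.* a ≡ b
      im-law = solve-∀ ℚ-ring

    ·-distribˡ : ∀ x y z → x · (y + z) ≡ x · y + x · z
    ·-distribˡ (a +√ b) (c +√ d) (e +√ f) = +√-cong (re-law a b c d e f Dℚ) (im-law a b c d e f)
      where
      re-law : ∀ a b c d e f δ → a ℚ.* (c ℚ.+ e) ℚ.+ b ℚ.* (d ℚ.+ f) ℚ.* δ ≡ (a ℚ.* c ℚ.+ b ℚ.* d ℚ.* δ) ℚ.+ (a ℚ.* e ℚ.+ b ℚ.* f ℚ.* δ)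
      re-law = solve-∀ ℚ-ring
      im-law : ∀ a b c d e f → a ℚ.* (d ℚ.+ f) ℚ.+ b ℚ.* (c ℚ.+ e) ≡ (a ℚ.* d ℚ.+ b ℚ.* c) ℚ.+ (a ℚ.* f ℚ.+ b ℚ.* e)
      im-law = solve-∀ ℚ-ring

  +-*-isCommutativeRing : IsCommutativeRing _+_ _*_ -_ zeroQ oneQ
  +-*-isCommutativeRing = record
    { isRing = record
      { +-isAbelianGroup = record
        { isGroup = record
          { isMonoid = record
            { isSemigroup = record
              { isMagma = record { isEquivalence = isEquivalence ; ∙-cong = cong₂ _+_ }
              ; assoc = λ { (a +√ b) (c +√ d) (e +√ f) → +√-cong (ℚ.+-assoc a c e) (ℚ.+-assoc b d f) } }
            ; identity = (λ { (a +√ b) → +√-cong (ℚ.+-identityˡ a) (ℚ.+-identityˡ b) })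
                       , (λ { (a +√ b) → +√-cong (ℚ.+-identityʳ a) (ℚ.+-identityʳ b) }) }
          ; inverse = (λ { (a +√ b) → +√-cong (ℚ.+-inverseˡ a) (ℚ.+-inverseˡ b) })
                    , (λ { (a +√ b) → +√-cong (ℚ.+-inverseʳ a) (ℚ.+-inverseʳ b) })
          ; ⁻¹-cong = cong (-_) }
        ; comm = λ { (a +√ b) (c +√ d) → +√-cong (ℚ.+-comm a c) (ℚ.+-comm b d) } }
      ; *-cong = cong₂ _*_
      ; *-assoc = *-assoc
      ; *-identity = *-identityˡ , λ x → trans (*-comm x oneQ) (*-identityˡ x)
      ; distrib = *-distribˡ , λ x y z → trans (*-comm (y + z) x) (trans (*-distribˡ x y z) (cong₂ _+_ (*-comm x y) (*-comm x z))) }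
    ; *-comm = *-comm }
    where
    open ≡-Reasoning
    *-assoc : ∀ x y z → (x * y) * z ≡ x * (y * z)
    *-assoc x y z = begin
      (x * y) * z  ≡⟨ trans (*≡mulQ (x * y) z) (cong (_· z) (*≡mulQ x y)) ⟩
      (x · y) · z  ≡⟨ ·-assoc x y z ⟩
      x · (y · z)  ≡⟨ trans (*≡mulQ x (y * z)) (cong (x ·_) (*≡mulQ y z)) ⟨
      x * (y * z)  ∎
    *-comm : ∀ x y → x * y ≡ y * x
    *-comm x y = trans (*≡mulQ x y) (trans (·-comm x y) (sym (*≡mulQ y x)))
    *-identityˡ : ∀ x → oneQ * x ≡ x
    *-identityˡ x = trans (*≡mulQ oneQ x) (·-identityˡ x)
    *-distribˡ : ∀ x y z → x * (y + z) ≡ x * y + x * z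
    *-distribˡ x y z = begin
      x * (y + z)    ≡⟨ *≡mulQ x (y + z) ⟩
      x · (y + z)    ≡⟨ ·-distribˡ x y z ⟩
      x · y + x · z  ≡⟨ cong₂ _+_ (*≡mulQ x y) (*≡mulQ x z) ⟨
      x * y + x * z  ∎

  commutativeRing : CommutativeRing _ _
  commutativeRing = record { isCommutativeRing = +-*-isCommutativeRing }

  open CommutativeRing commutativeRing public using (+-comm; *-comm; *-identityˡ; *-identityʳ; +-identityˡ)

  ring : AlmostCommutativeRing _ _
  ring = fromCommutativeRing commutativeRing (λ x → dec⇒maybe (zeroQ ≟ x))

  *-inverse-unique : ∀ x {y z} → x * y ≡ oneQ → x * z ≡ oneQ → y ≡ z
  *-inverse-unique x {y} {z} xy≡1 xz≡1 = begin
    y                                        ≡⟨ law x y z ⟩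
    z + z * (x * y - oneQ) + y * (oneQ - x * z)  ≡⟨ cong₂ (λ s t → z + z * (s - oneQ) + y * (oneQ - t)) xy≡1 xz≡1 ⟩
    z + z * (oneQ - oneQ) + y * (oneQ - oneQ)    ≡⟨ law₁ y z ⟩
    z                                        ∎
    where
    open ≡-Reasoning
    law : ∀ x y z → y ≡ z + z * (x * y - oneQ) + y * (oneQ - x * z)
    law = solve-∀ ring
    law₁ : ∀ y z → z + z * (oneQ - oneQ) + y * (oneQ - oneQ) ≡ z
    law₁ = solve-∀ ring

  neg-≢0 : ∀ {x} → x ≢ zeroQ → - x ≢ zeroQ
  neg-≢0 {x} x≢0 -x≡0 = x≢0 (trans (law x) (cong -_ -x≡0))
    where
    law : ∀ x → x ≡ - - x
    law = solve-∀ ring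

  conj-+ : ∀ x y → conjQ (x + y) ≡ conjQ x + conjQ y
  conj-+ (a +√ b) (c +√ d) = +√-cong refl (ℚ.neg-distrib-+ b d)

  conj-* : ∀ x y → conjQ (x * y) ≡ conjQ x * conjQ y
  conj-* (a +√ b) (c +√ d) = begin
    conjQ ((a +√ b) * (c +√ d))   ≡⟨ cong conjQ (*≡mulQ (a +√ b) (c +√ d)) ⟩
    conjQ (mulQ D (a +√ b) (c +√ d))  ≡⟨ +√-cong (re-law a b c d Dℚ) (im-law a b c d) ⟩
    mulQ D (a +√ (ℚ.- b)) (c +√ (ℚ.- d))  ≡⟨ *≡mulQ (a +√ (ℚ.- b)) (c +√ (ℚ.- d)) ⟨
    (a +√ (ℚ.- b)) * (c +√ (ℚ.- d))   ∎
    where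
    open ≡-Reasoning
    re-law : ∀ a b c d δ → a ℚ.* c ℚ.+ b ℚ.* d ℚ.* δ ≡ a ℚ.* c ℚ.+ (ℚ.- b) ℚ.* (ℚ.- d) ℚ.* δ
    re-law = solve-∀ ℚ-ring
    im-law : ∀ a b c d → ℚ.- (a ℚ.* d ℚ.+ b ℚ.* c) ≡ a ℚ.* (ℚ.- d) ℚ.+ (ℚ.- b) ℚ.* c
    im-law = solve-∀ ℚ-ring

  conj-- : ∀ x y → conjQ (x - y) ≡ conjQ x - conjQ y
  conj-- x y = conj-+ x (- y)

  conj-involutive : ∀ x → conjQ (conjQ x) ≡ x
  conj-involutive (a +√ b) = +√-cong refl (ℚ-Facts.neg-involutive b)

  conj-fixed⇒im≡0 : ∀ x → conjQ x ≡ x → im x ≡ 0ℚ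
  conj-fixed⇒im≡0 (a +√ b) x̄≡x = trans (law b) (trans (cong (λ t → ½ ℚ.* (b ℚ.- t)) (cong im x̄≡x)) (law₀ b))
    where
    ½ : ℚ
    ½ = + 1 ℚ./ 2
    law : ∀ b → b ≡ ½ ℚ.* (b ℚ.- ℚ.- b)
    law = solve-∀ ℚ-ring
    law₀ : ∀ b → ½ ℚ.* (b ℚ.- b) ≡ 0ℚ
    law₀ = solve-∀ ℚ-ring

  conj-≢0 : ∀ {x} → conjQ x ≢ x → conjQ x ≢ zeroQ
  conj-≢0 {x} x̄≢x x̄≡0 = x̄≢x (trans x̄≡0 (trans (sym (cong conjQ x̄≡0)) (conj-involutive x)))

  fromℤ-+ : ∀ m n → fromℤQ (m ℤ.+ n) ≡ fromℤQ m + fromℤQ n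
  fromℤ-+ m n = +√-cong (ι-+ m n) refl

  fromℤ-neg : ∀ n → fromℤQ (ℤ.- n) ≡ - fromℤQ n
  fromℤ-neg n = +√-cong (ι-neg n) refl

  fromℤ-- : ∀ m n → fromℤQ (m ℤ.- n) ≡ fromℤQ m - fromℤQ n
  fromℤ-- m n = trans (fromℤ-+ m (ℤ.- n)) (cong (λ t → fromℤQ m + t) (fromℤ-neg n))

  record Step (c : ℤ) (x y : QD) : Set where
    constructor step
    field equation : y * (x - fromℤQ c) ≡ oneQ

  -- Chain L t x : x = [L₀, L₁, …, Lₖ, t]
  data Chain : List ℤ → QD → QD → Set where
    []  : ∀ {t} → Chain [] t t
    _∷_ : ∀ {c L t x y} → Step c x y → Chain L t y → Chain (c ∷ L) t x

  chain-++ : ∀ {L L′ t m x} → Chain L m x → Chain L′ t m → Chain (L ++ L′) t x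
  chain-++ [] ch′ = ch′
  chain-++ (st ∷ ch) ch′ = st ∷ chain-++ ch ch′

  chain-split : ∀ L {L′ t x} → Chain (L ++ L′) t x → Σ QD λ m → Chain L m x × Chain L′ t m
  chain-split [] ch = _ , [] , ch
  chain-split (c ∷ L) (st ∷ ch) with chain-split L ch
  ... | m , ch₁ , ch₂ = m , st ∷ ch₁ , ch₂

  step⇒≢0 : ∀ {c x y} → Step c x y → y ≢ zeroQ
  step⇒≢0 {c} {x} (step e) refl = case trans (sym e) (law (x - fromℤQ c)) of λ ()
    where
    law : ∀ t → zeroQ * t ≡ zeroQ
    law = solve-∀ ring

  step-pred : ∀ {c x y} → Step c x y → Step (c ℤ.- + 1) (x - oneQ) y
  step-pred {c} {x} {y} (step e) = step (trans (cong (λ t → y * (x - oneQ - t)) (fromℤ-- c (+ 1))) (trans (cong (y *_) (law x (fromℤQ c))) e))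
    where
    law : ∀ x c → x - oneQ - (c - oneQ) ≡ x - c
    law = solve-∀ ring

  step-neg : ∀ {c x y} → Step c x y → Step (ℤ.- c) (- x) (- y)
  step-neg {c} {x} {y} (step e) = step (trans (cong (λ t → - y * (- x - t)) (fromℤ-neg c)) (trans (law x y (fromℤQ c)) e))
    where
    law : ∀ x y c → - y * (- x - - c) ≡ y * (x - c)
    law = solve-∀ ring

  step-merge-zero : ∀ {x y v v₁ v₂ v₃} → Step x v v₁ → Step (+ 0) v₁ v₂ → Step y v₂ v₃ → Step (x ℤ.+ y) v v₃
  step-merge-zero {x} {y} {v} {v₁} {v₂} {v₃} (step e₁) (step e₂) (step e₃) = step (trans (cong (v₃ *_) v-[x+y]≡v₂-y) e₃)
    where
    v-x≡v₂ : v - fromℤQ x ≡ v₂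
    v-x≡v₂ = *-inverse-unique v₁ e₁ (trans (*-comm v₁ v₂) (trans (cong (v₂ *_) (law₀ v₁)) e₂))
      where
      law₀ : ∀ v → v ≡ v - zeroQ
      law₀ = solve-∀ ring
    v-[x+y]≡v₂-y : v - fromℤQ (x ℤ.+ y) ≡ v₂ - fromℤQ y
    v-[x+y]≡v₂-y = trans (cong (λ t → v - t) (fromℤ-+ x y)) (trans (law v (fromℤQ x) (fromℤQ y)) (cong (_- fromℤQ y) v-x≡v₂))
      where
      law : ∀ v a b → v - (a + b) ≡ v - a - b
      law = solve-∀ ring

  -- x - k = 1/z = -w
  step-flip : ∀ {k q x z w w₁} → Step k x z → Step (+ 0) (- z) w → Step q w w₁ → Step (q ℤ.- k) (- x) w₁
  step-flip {k} {q} {x} {z} {w} {w₁} (step e₁) (step e₂) (step e₃) = step (trans (cong (w₁ *_) -x-[q-k]≡w-q) e₃)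
    where
    x-k≡-w : x - fromℤQ k ≡ - w
    x-k≡-w = *-inverse-unique z e₁ (trans (law₁ z w) e₂)
      where
      law₁ : ∀ z w → z * - w ≡ w * (- z - zeroQ)
      law₁ = solve-∀ ring
    -x-[q-k]≡w-q : - x - fromℤQ (q ℤ.- k) ≡ w - fromℤQ q
    -x-[q-k]≡w-q = begin
      - x - fromℤQ (q ℤ.- k)        ≡⟨ cong (λ t → - x - t) (fromℤ-- q k) ⟩
      - x - (fromℤQ q - fromℤQ k)   ≡⟨ law x (fromℤQ q) (fromℤQ k) ⟩
      - (x - fromℤQ k) - fromℤQ q   ≡⟨ cong (λ t → - t - fromℤQ q) x-k≡-w ⟩
      - - w - fromℤQ q              ≡⟨ cong (_- fromℤQ q) (law₂ w) ⟩
      w - fromℤQ q                  ∎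
      where
      open ≡-Reasoning
      law : ∀ x q k → - x - (q - k) ≡ - (x - k) - q
      law = solve-∀ ring
      law₂ : ∀ w → - - w ≡ w
      law₂ = solve-∀ ring

  conj-step : ∀ {c x y} → Step c x y → Step c (conjQ x) (conjQ y)
  conj-step {c} {x} {y} (step e) = step (trans (sym (trans (conj-* y (x - fromℤQ c)) (cong (conjQ y *_) (conj-- x (fromℤQ c))))) (cong conjQ e))

  conj-chain : ∀ {L t x} → Chain L t x → Chain L (conjQ t) (conjQ x)
  conj-chain [] = []
  conj-chain (st ∷ ch) = conj-step st ∷ conj-chain ch

  -- irrationality of x is expressed as conjQ x ≢ x
  step-irrational : ∀ {c x y} → Step c x y → conjQ x ≢ x → conjQ y ≢ y
  step-irrational {c} {x} {y} st@(step e) x̄≢x ȳ≡y = x̄≢x x̄≡x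
    where
    x̄-c≡x-c : conjQ x - fromℤQ c ≡ x - fromℤQ c
    x̄-c≡x-c = *-inverse-unique y (subst (λ t → t * (conjQ x - fromℤQ c) ≡ oneQ) ȳ≡y (Step.equation (conj-step st))) e
    x̄≡x : conjQ x ≡ x
    x̄≡x = trans (law (conjQ x) (fromℤQ c)) (trans (cong (_+ fromℤQ c) x̄-c≡x-c) (sym (law x (fromℤQ c))))
      where
      law : ∀ x c → x ≡ x - c + c
      law = solve-∀ ring

  chain-irrational : ∀ {L t x} → Chain L t x → conjQ x ≢ x → conjQ t ≢ t
  chain-irrational [] x̄≢x = x̄≢x
  chain-irrational (st ∷ ch) x̄≢x = chain-irrational ch (step-irrational st x̄≢x)

  record Matrix : Set where
    constructor ⟨_,_,_,_⟩
    field p p′ q q′ : QD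

  -- the product of the matrices ⟨ c , 1 , 1 , 0 ⟩ for c in L
  convergents : List ℤ → Matrix
  convergents [] = ⟨ oneQ , zeroQ , zeroQ , oneQ ⟩
  convergents (c ∷ L) = ⟨ fromℤQ c * p + q , fromℤQ c * p′ + q′ , p , p′ ⟩
    where open Matrix (convergents L)

  chain-möbius : ∀ {L t x} → Chain L t x → let open Matrix (convergents L) in x * (q * t + q′) ≡ p * t + p′
  chain-möbius {t = t} [] = law t
    where
    law : ∀ t → t * (zeroQ * t + oneQ) ≡ oneQ * t + zeroQ
    law = solve-∀ ring
  chain-möbius {c ∷ L} {t} {x} (_∷_ {y = y} (step e) ch) = begin
    x * (p * t + p′)
      ≡⟨ law x y t C p p′ q q′ ⟩
    C * p * t + q * t + (C * p′ + q′) + (x - C) * (p * t + p′ - y * (q * t + q′)) + (q * t + q′) * (y * (x - C) - oneQ)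
      ≡⟨ cong₂ (λ s u → C * p * t + q * t + (C * p′ + q′) + (x - C) * (p * t + p′ - s) + (q * t + q′) * (u - oneQ)) (chain-möbius ch) e ⟩
    C * p * t + q * t + (C * p′ + q′) + (x - C) * (p * t + p′ - (p * t + p′)) + (q * t + q′) * (oneQ - oneQ)
      ≡⟨ law₁ x t C p p′ q q′ ⟩
    (C * p + q) * t + (C * p′ + q′)
      ∎
    where
    open ≡-Reasoning
    open Matrix (convergents L)
    C = fromℤQ c
    law : ∀ x y t C p p′ q q′ → x * (p * t + p′)
          ≡ C * p * t + q * t + (C * p′ + q′) + (x - C) * (p * t + p′ - y * (q * t + q′)) + (q * t + q′) * (y * (x - C) - oneQ)
    law = solve-∀ ring
    law₁ : ∀ x t C p p′ q q′ → C * p * t + q * t + (C * p′ + q′) + (x - C) * (p * t + p′ - (p * t + p′)) + (q * t + q′) * (oneQ - oneQ)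
           ≡ (C * p + q) * t + (C * p′ + q′)
    law₁ = solve-∀ ring

  module Field (nonSquare : NonSquare D) where
    open ℚ-Facts
    open import Data.Rational using (_≤_; _<_)

    √D-irrational : ∀ r → r ℚ.* r ≢ Dℚ
    √D-irrational r@(mkℚ n d-1 coprime) r²≡D =
      nonSquare ℤ.∣ n ∣ (trans ∣n∣²≡D*d² (trans (cong (λ e → D ℕ.* (e ℕ.* e)) d≡1) (ℕ.*-identityʳ D)))
      where
      d = suc d-1
      n²≡D*d² : n ℤ.* n ℤ.* + 1 ≡ + D ℤ.* + (d ℕ.* d)
      n²≡D*d² with ℚᵘ.≃-trans (ℚᵘ.≃-sym (ℚ.toℚᵘ-homo-* r r)) (ℚᵘ.≃-trans (ℚ.toℚᵘ-cong r²≡D) (toℚᵘ-ι (+ D)))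
      ... | *≡* eq = eq
      ∣n∣²≡D*d² : ℤ.∣ n ∣ ℕ.* ℤ.∣ n ∣ ≡ D ℕ.* (d ℕ.* d)
      ∣n∣²≡D*d² = begin
        ℤ.∣ n ∣ ℕ.* ℤ.∣ n ∣        ≡⟨ ℤ.abs-* n n ⟨
        ℤ.∣ n ℤ.* n ∣              ≡⟨ cong ℤ.∣_∣ (ℤ.*-identityʳ (n ℤ.* n)) ⟨
        ℤ.∣ n ℤ.* n ℤ.* + 1 ∣      ≡⟨ cong ℤ.∣_∣ n²≡D*d² ⟩
        ℤ.∣ + D ℤ.* + (d ℕ.* d) ∣  ≡⟨ ℤ.abs-* (+ D) (+ (d ℕ.* d)) ⟩
        D ℕ.* (d ℕ.* d)            ∎
        where open ≡-Reasoning
      d∣∣n∣ : d ∣ ℤ.∣ n ∣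
      d∣∣n∣ = coprime-divisor (Coprime.sym (Coprime.recompute coprime))
                (divides (D ℕ.* d) (trans ∣n∣²≡D*d² (sym (ℕ.*-assoc D d d))))
      d≡1 : d ≡ 1
      d≡1 = Coprime.recompute coprime (d∣∣n∣ , ∣-refl)

    norm : QD → ℚ
    norm (a +√ b) = a ℚ.* a ℚ.- b ℚ.* b ℚ.* Dℚ

    norm≡0⇒≡0 : ∀ x → norm x ≡ 0ℚ → x ≡ zeroQ
    norm≡0⇒≡0 (a +√ b) N≡0 with b ℚ.≟ 0ℚ
    ... | yes refl = +√-cong (p*p≡0⇒p≡0 a (trans (law a Dℚ) N≡0)) refl
      where
      law : ∀ a δ → a ℚ.* a ≡ a ℚ.* a ℚ.- 0ℚ ℚ.* 0ℚ ℚ.* δ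
      law = solve-∀ ℚ-ring
    ... | no b≢0 = ⊥-elim (√D-irrational (a ℚ.* recip b) (begin
      a ℚ.* recip b ℚ.* (a ℚ.* recip b)                          ≡⟨ law₁ a b (recip b) Dℚ ⟩
      (a ℚ.* a ℚ.- b ℚ.* b ℚ.* Dℚ) ℚ.* (recip b ℚ.* recip b) ℚ.+ Dℚ ℚ.* (b ℚ.* recip b) ℚ.* (b ℚ.* recip b)
                                                                 ≡⟨ cong₂ (λ s t → s ℚ.* (recip b ℚ.* recip b) ℚ.+ Dℚ ℚ.* t ℚ.* t) N≡0 (*-recipʳ b b≢0) ⟩
      0ℚ ℚ.* (recip b ℚ.* recip b) ℚ.+ Dℚ ℚ.* 1ℚ ℚ.* 1ℚ        ≡⟨ law₂ (recip b) Dℚ ⟩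
      Dℚ                                                         ∎))
      where
      open ≡-Reasoning
      law₁ : ∀ a b r δ → a ℚ.* r ℚ.* (a ℚ.* r) ≡ (a ℚ.* a ℚ.- b ℚ.* b ℚ.* δ) ℚ.* (r ℚ.* r) ℚ.+ δ ℚ.* (b ℚ.* r) ℚ.* (b ℚ.* r)
      law₁ = solve-∀ ℚ-ring
      law₂ : ∀ r δ → 0ℚ ℚ.* (r ℚ.* r) ℚ.+ δ ℚ.* 1ℚ ℚ.* 1ℚ ≡ δ
      law₂ = solve-∀ ℚ-ring

    -- the conjugate divided by the norm (junk value 0⁻¹ = 0)
    infix 9 _⁻¹
    _⁻¹ : QD → QD
    x@(a +√ b) ⁻¹ = (a ℚ.* recip (norm x)) +√ (ℚ.- b ℚ.* recip (norm x))

    *-inverseʳ : ∀ x → x ≢ zeroQ → x * x ⁻¹ ≡ oneQ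
    *-inverseʳ x@(a +√ b) x≢0 = begin
      x * x ⁻¹                 ≡⟨ *≡mulQ x (x ⁻¹) ⟩
      mulQ D x (x ⁻¹)          ≡⟨ +√-cong (re-law a b (recip (norm x)) Dℚ) (im-law a b (recip (norm x))) ⟩
      (norm x ℚ.* recip (norm x)) +√ 0ℚ  ≡⟨ cong (_+√ 0ℚ) (*-recipʳ (norm x) (λ N≡0 → x≢0 (norm≡0⇒≡0 x N≡0))) ⟩
      oneQ                     ∎
      where
      open ≡-Reasoning
      re-law : ∀ a b r δ → a ℚ.* (a ℚ.* r) ℚ.+ b ℚ.* (ℚ.- b ℚ.* r) ℚ.* δ ≡ (a ℚ.* a ℚ.- b ℚ.* b ℚ.* δ) ℚ.* r
      re-law = solve-∀ ℚ-ring
      im-law : ∀ a b r → a ℚ.* (ℚ.- b ℚ.* r) ℚ.+ b ℚ.* (a ℚ.* r) ≡ 0ℚ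
      im-law = solve-∀ ℚ-ring

    *-cancelˡ-zero : ∀ {x y} → x ≢ zeroQ → x * y ≡ zeroQ → y ≡ zeroQ
    *-cancelˡ-zero {x} {y} x≢0 xy≡0 = begin
      y                          ≡⟨ law x y (x ⁻¹) ⟩
      y * (oneQ - x * x ⁻¹) + x ⁻¹ * (x * y)  ≡⟨ cong₂ (λ s t → y * (oneQ - s) + x ⁻¹ * t) (*-inverseʳ x x≢0) xy≡0 ⟩
      y * (oneQ - oneQ) + x ⁻¹ * zeroQ        ≡⟨ law₀ y (x ⁻¹) ⟩
      zeroQ                      ∎
      where
      open ≡-Reasoning
      law : ∀ x y x⁻ → y ≡ y * (oneQ - x * x⁻) + x⁻ * (x * y)
      law = solve-∀ ring
      law₀ : ∀ y x⁻ → y * (oneQ - oneQ) + x⁻ * zeroQ ≡ zeroQ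
      law₀ = solve-∀ ring

    -- The order of ℚ(√D) as a subfield of ℝ

    0²D≡0 : 0ℚ ℚ.* 0ℚ ℚ.* Dℚ ≡ 0ℚ
    0²D≡0 = trans (cong (ℚ._* Dℚ) (ℚ.*-zeroˡ 0ℚ)) (ℚ.*-zeroˡ Dℚ)

    0≤D : 0ℚ ≤ Dℚ
    0≤D = ι-mono-≤ {+ 0} {+ D} (ℤ.+≤+ ℕ.z≤n)

    0≤b²D : ∀ b → 0ℚ ≤ b ℚ.* b ℚ.* Dℚ
    0≤b²D b = 0≤p*q (0≤p*p b) 0≤D

    -- a + b√D ≥ 0 iff whichever of a and b√D has the larger square is ≥ 0
    data NonNeg : QD → Set where
      re-dominant : ∀ {a b} → 0ℚ ≤ a → b ℚ.* b ℚ.* Dℚ ≤ a ℚ.* a → NonNeg (a +√ b)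
      im-dominant : ∀ {a b} → 0ℚ ≤ b → a ℚ.* a ≤ b ℚ.* b ℚ.* Dℚ → NonNeg (a +√ b)

    fromNonNegQ : ∀ x → NonNegQ D x → NonNeg x
    fromNonNegQ (a +√ b) (inj₁ (0≤a , 0≤b)) with ℚ.≤-total (b ℚ.* b ℚ.* Dℚ) (a ℚ.* a)
    ... | inj₁ b²D≤a² = re-dominant 0≤a b²D≤a²
    ... | inj₂ a²≤b²D = im-dominant 0≤b a²≤b²D
    fromNonNegQ (a +√ b) (inj₂ (inj₁ (0≤a , _ , b²D≤a²))) = re-dominant 0≤a b²D≤a²
    fromNonNegQ (a +√ b) (inj₂ (inj₂ (_ , 0≤b , a²≤b²D))) = im-dominant 0≤b a²≤b²D

    toNonNegQ : ∀ {x} → NonNeg x → NonNegQ D x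
    toNonNegQ {a +√ b} (re-dominant 0≤a b²D≤a²) with 0ℚ ℚ.≤? b
    ... | yes 0≤b = inj₁ (0≤a , 0≤b)
    ... | no 0≰b = inj₂ (inj₁ (0≤a , ℚ.≰⇒> 0≰b , b²D≤a²))
    toNonNegQ {a +√ b} (im-dominant 0≤b a²≤b²D) with 0ℚ ℚ.≤? a
    ... | yes 0≤a = inj₁ (0≤a , 0≤b)
    ... | no 0≰a = inj₂ (inj₂ (ℚ.≰⇒> 0≰a , 0≤b , a²≤b²D))

    private
      norm-*₁ : ∀ a b c d δ → (a ℚ.* c ℚ.+ b ℚ.* d ℚ.* δ) ℚ.* (a ℚ.* c ℚ.+ b ℚ.* d ℚ.* δ) ℚ.- (a ℚ.* d ℚ.+ b ℚ.* c) ℚ.* (a ℚ.* d ℚ.+ b ℚ.* c) ℚ.* δ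
                              ≡ (a ℚ.* a ℚ.- b ℚ.* b ℚ.* δ) ℚ.* (c ℚ.* c ℚ.- d ℚ.* d ℚ.* δ)
      norm-*₁ = solve-∀ ℚ-ring
      norm-*₂ : ∀ a b c d δ → (a ℚ.* d ℚ.+ b ℚ.* c) ℚ.* (a ℚ.* d ℚ.+ b ℚ.* c) ℚ.* δ ℚ.- (a ℚ.* c ℚ.+ b ℚ.* d ℚ.* δ) ℚ.* (a ℚ.* c ℚ.+ b ℚ.* d ℚ.* δ)
                              ≡ (a ℚ.* a ℚ.- b ℚ.* b ℚ.* δ) ℚ.* (d ℚ.* d ℚ.* δ ℚ.- c ℚ.* c)
      norm-*₂ = solve-∀ ℚ-ring
      norm-*₃ : ∀ a b c d δ → (a ℚ.* c ℚ.+ b ℚ.* d ℚ.* δ) ℚ.* (a ℚ.* c ℚ.+ b ℚ.* d ℚ.* δ) ℚ.- (a ℚ.* d ℚ.+ b ℚ.* c) ℚ.* (a ℚ.* d ℚ.+ b ℚ.* c) ℚ.* δ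
                              ≡ (b ℚ.* b ℚ.* δ ℚ.- a ℚ.* a) ℚ.* (d ℚ.* d ℚ.* δ ℚ.- c ℚ.* c)
      norm-*₃ = solve-∀ ℚ-ring
      square-* : ∀ p q → p ℚ.* q ℚ.* (p ℚ.* q) ≡ p ℚ.* p ℚ.* (q ℚ.* q)
      square-* = solve-∀ ℚ-ring
      square-*D : ∀ b d δ → b ℚ.* d ℚ.* δ ℚ.* (b ℚ.* d ℚ.* δ) ≡ b ℚ.* b ℚ.* δ ℚ.* (d ℚ.* d ℚ.* δ)
      square-*D = solve-∀ ℚ-ring
      swap-*D : ∀ b d δ → b ℚ.* b ℚ.* (d ℚ.* d ℚ.* δ) ≡ d ℚ.* d ℚ.* (b ℚ.* b ℚ.* δ)
      swap-*D = solve-∀ ℚ-ring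

      nonNeg-mulQ-re-re : ∀ a b c d → 0ℚ ≤ a → b ℚ.* b ℚ.* Dℚ ≤ a ℚ.* a → 0ℚ ≤ c → d ℚ.* d ℚ.* Dℚ ≤ c ℚ.* c →
                          NonNeg (mulQ D (a +√ b) (c +√ d))
      nonNeg-mulQ-re-re a b c d 0≤a b²D≤a² 0≤c d²D≤c² =
        re-dominant (p²≤q²⇒0≤q+p (0≤p*q 0≤a 0≤c) (subst₂ _≤_ (sym (square-*D b d Dℚ)) (sym (square-* a c))
                                                         (*-mono-≤-nonNeg (0≤b²D b) b²D≤a² (0≤b²D d) d²D≤c²)))
                    (0≤q-p⇒p≤q (subst (0ℚ ≤_) (sym (norm-*₁ a b c d Dℚ)) (0≤p*q (p≤q⇒0≤q-p b²D≤a²) (p≤q⇒0≤q-p d²D≤c²))))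

      nonNeg-mulQ-re-im : ∀ a b c d → 0ℚ ≤ a → b ℚ.* b ℚ.* Dℚ ≤ a ℚ.* a → 0ℚ ≤ d → c ℚ.* c ≤ d ℚ.* d ℚ.* Dℚ →
                          NonNeg (mulQ D (a +√ b) (c +√ d))
      nonNeg-mulQ-re-im a b c d 0≤a b²D≤a² 0≤d c²≤d²D =
        im-dominant (p²≤q²⇒0≤q+p (0≤p*q 0≤a 0≤d) (subst₂ _≤_ (sym (square-* b c)) (trans (ℚ.*-comm (d ℚ.* d) (a ℚ.* a)) (sym (square-* a d)))
                       (ℚ.≤-trans (ℚ.*-monoˡ-≤-nonNeg (b ℚ.* b) {{ℚ.nonNegative (0≤p*p b)}} c²≤d²D)
                                  (subst (_≤ d ℚ.* d ℚ.* (a ℚ.* a)) (sym (swap-*D b d Dℚ))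
                                         (ℚ.*-monoˡ-≤-nonNeg (d ℚ.* d) {{ℚ.nonNegative (0≤p*p d)}} b²D≤a²)))))
                    (0≤q-p⇒p≤q (subst (0ℚ ≤_) (sym (norm-*₂ a b c d Dℚ)) (0≤p*q (p≤q⇒0≤q-p b²D≤a²) (p≤q⇒0≤q-p c²≤d²D))))

      nonNeg-mulQ-im-im : ∀ a b c d → 0ℚ ≤ b → a ℚ.* a ≤ b ℚ.* b ℚ.* Dℚ → 0ℚ ≤ d → c ℚ.* c ≤ d ℚ.* d ℚ.* Dℚ →
                          NonNeg (mulQ D (a +√ b) (c +√ d))
      nonNeg-mulQ-im-im a b c d 0≤b a²≤b²D 0≤d c²≤d²D =
        re-dominant (subst (0ℚ ≤_) (ℚ.+-comm (b ℚ.* d ℚ.* Dℚ) (a ℚ.* c))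
                       (p²≤q²⇒0≤q+p (0≤p*q (0≤p*q 0≤b 0≤d) 0≤D) (subst₂ _≤_ (sym (square-* a c)) (sym (square-*D b d Dℚ))
                                                                   (*-mono-≤-nonNeg (0≤p*p a) a²≤b²D (0≤p*p c) c²≤d²D))))
                    (0≤q-p⇒p≤q (subst (0ℚ ≤_) (sym (norm-*₃ a b c d Dℚ)) (0≤p*q (p≤q⇒0≤q-p a²≤b²D) (p≤q⇒0≤q-p c²≤d²D))))

    nonNeg-* : ∀ {x y} → NonNeg x → NonNeg y → NonNeg (x * y)
    nonNeg-* {x} {y} nx ny = subst NonNeg (sym (*≡mulQ x y)) (mulQ-case nx ny)
      where
      mulQ-case : ∀ {x y} → NonNeg x → NonNeg y → NonNeg (mulQ D x y)
      mulQ-case (re-dominant {a} {b} 0≤a b²D≤a²) (re-dominant {c} {d} 0≤c d²D≤c²) = nonNeg-mulQ-re-re a b c d 0≤a b²D≤a² 0≤c d²D≤c²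
      mulQ-case (re-dominant {a} {b} 0≤a b²D≤a²) (im-dominant {c} {d} 0≤d c²≤d²D) = nonNeg-mulQ-re-im a b c d 0≤a b²D≤a² 0≤d c²≤d²D
      mulQ-case {x} {y} (im-dominant {a} {b} 0≤b a²≤b²D) (re-dominant {c} {d} 0≤c d²D≤c²) =
        subst NonNeg (trans (sym (*≡mulQ y x)) (trans (*-comm y x) (*≡mulQ x y))) (nonNeg-mulQ-re-im c d a b 0≤c d²D≤c² 0≤b a²≤b²D)
      mulQ-case (im-dominant {a} {b} 0≤b a²≤b²D) (im-dominant {c} {d} 0≤d c²≤d²D) = nonNeg-mulQ-im-im a b c d 0≤b a²≤b²D 0≤d c²≤d²D

    nonNeg-total : ∀ x → NonNeg x ⊎ NonNeg (- x)
    nonNeg-total (a +√ b) with ℚ.≤-total (b ℚ.* b ℚ.* Dℚ) (a ℚ.* a)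
    ... | inj₁ b²D≤a² with ℚ.≤-total 0ℚ a
    ...   | inj₁ 0≤a = inj₁ (re-dominant 0≤a b²D≤a²)
    ...   | inj₂ a≤0 = inj₂ (re-dominant (ℚ.neg-antimono-≤ a≤0) (subst₂ _≤_ (cong (ℚ._* Dℚ) (sym (neg-square b))) (sym (neg-square a)) b²D≤a²))
    nonNeg-total (a +√ b) | inj₂ a²≤b²D with ℚ.≤-total 0ℚ b
    ...   | inj₁ 0≤b = inj₁ (im-dominant 0≤b a²≤b²D)
    ...   | inj₂ b≤0 = inj₂ (im-dominant (ℚ.neg-antimono-≤ b≤0) (subst₂ _≤_ (sym (neg-square a)) (cong (ℚ._* Dℚ) (sym (neg-square b))) a²≤b²D))

    nonNeg-antisym : ∀ {x} → NonNeg x → NonNeg (- x) → x ≡ zeroQ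
    nonNeg-antisym {x@(a +√ b)} nx n-x = norm≡0⇒≡0 x (trans (cong (ℚ._- b ℚ.* b ℚ.* Dℚ) (a²≡b²D nx n-x)) (ℚ.+-inverseʳ (b ℚ.* b ℚ.* Dℚ)))
      where
      ≡0 : ∀ {p} → 0ℚ ≤ p → 0ℚ ≤ ℚ.- p → p ≡ 0ℚ
      ≡0 {p} 0≤p 0≤-p = ℚ.≤-antisym (subst (_≤ 0ℚ) (neg-involutive p) (ℚ.neg-antimono-≤ 0≤-p)) 0≤p
      a²≡b²D : NonNeg x → NonNeg (- x) → a ℚ.* a ≡ b ℚ.* b ℚ.* Dℚ
      a²≡b²D (re-dominant 0≤a b²D≤a²) (re-dominant 0≤-a _) =
        ℚ.≤-antisym (subst (_≤ b ℚ.* b ℚ.* Dℚ) (sym (cong (λ p → p ℚ.* p) (≡0 0≤a 0≤-a))) (0≤b²D b)) b²D≤a²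
      a²≡b²D (re-dominant _ b²D≤a²) (im-dominant _ a²≤b²D) =
        ℚ.≤-antisym (subst₂ _≤_ (neg-square a) (cong (ℚ._* Dℚ) (neg-square b)) a²≤b²D) b²D≤a²
      a²≡b²D (im-dominant _ a²≤b²D) (re-dominant _ b²D≤a²) =
        ℚ.≤-antisym a²≤b²D (subst₂ _≤_ (cong (ℚ._* Dℚ) (neg-square b)) (neg-square a) b²D≤a²)
      a²≡b²D (im-dominant 0≤b a²≤b²D) (im-dominant 0≤-b _) =
        ℚ.≤-antisym a²≤b²D (subst (_≤ a ℚ.* a) (sym (cong (λ p → p ℚ.* p ℚ.* Dℚ) (≡0 0≤b 0≤-b))) (subst (_≤ a ℚ.* a) (sym 0²D≡0) (0≤p*p a)))

    ¬nonNeg-minus1 : ¬ NonNeg (- oneQ)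
    ¬nonNeg-minus1 (re-dominant (ℚ.*≤* ()) _)
    ¬nonNeg-minus1 (im-dominant _ 1≤0*0*D) with subst (1ℚ ≤_) 0²D≡0 1≤0*0*D
    ... | ℚ.*≤* (ℤ.+≤+ ())

    nonNeg-1+ : ∀ {x} → NonNeg x → NonNeg (oneQ + x)
    nonNeg-1+ {e +√ f} nx = subst (λ t → NonNeg ((1ℚ ℚ.+ e) +√ t)) (sym (ℚ.+-identityˡ f)) (shift nx)
      where
      e≤1+e : e ≤ 1ℚ ℚ.+ e
      e≤1+e = subst (_≤ 1ℚ ℚ.+ e) (ℚ.+-identityˡ e) (ℚ.+-monoˡ-≤ e {0ℚ} {1ℚ} (ℚ.*≤* (ℤ.+≤+ ℕ.z≤n)))
      shift : NonNeg (e +√ f) → NonNeg ((1ℚ ℚ.+ e) +√ f)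
      shift (re-dominant 0≤e f²D≤e²) = re-dominant (ℚ.≤-trans 0≤e e≤1+e) (ℚ.≤-trans f²D≤e² (*-mono-≤-nonNeg 0≤e e≤1+e 0≤e e≤1+e))
      shift (im-dominant 0≤f e²≤f²D) with ℚ.≤-total 0ℚ (1ℚ ℚ.+ e)
      ... | inj₁ 0≤1+e = fromNonNegQ ((1ℚ ℚ.+ e) +√ f) (inj₁ (0≤1+e , 0≤f))
      ... | inj₂ 1+e≤0 = im-dominant 0≤f (ℚ.≤-trans (subst₂ _≤_ (neg-square (1ℚ ℚ.+ e)) (neg-square e) -1-e²≤-e²) e²≤f²D)
        where
        -1-e²≤-e² : ℚ.- (1ℚ ℚ.+ e) ℚ.* ℚ.- (1ℚ ℚ.+ e) ≤ ℚ.- e ℚ.* ℚ.- e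
        -1-e²≤-e² = *-mono-≤-nonNeg (ℚ.neg-antimono-≤ 1+e≤0) (ℚ.neg-antimono-≤ e≤1+e) (ℚ.neg-antimono-≤ 1+e≤0) (ℚ.neg-antimono-≤ e≤1+e)

    nonNeg-recip : ∀ {x y} → NonNeg x → x * y ≡ oneQ → NonNeg y
    nonNeg-recip {x} {y} nx xy≡1 with nonNeg-total y
    ... | inj₁ ny = ny
    ... | inj₂ n-y = ⊥-elim (¬nonNeg-minus1 (subst NonNeg (trans (law x y) (cong -_ xy≡1)) (nonNeg-* nx n-y)))
      where
      law : ∀ x y → x * - y ≡ - (x * y)
      law = solve-∀ ring

    -- x + y = x (1 + y x⁻¹), and y x⁻¹ ≥ 0
    nonNeg-+ : ∀ {x y} → NonNeg x → NonNeg y → NonNeg (x + y)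
    nonNeg-+ {x} {y} nx ny with x ≟ zeroQ
    ... | yes refl = subst NonNeg (sym (+-identityˡ y)) ny
    ... | no x≢0 = subst NonNeg x[1+yx⁻¹]≡x+y (nonNeg-* nx (nonNeg-1+ (nonNeg-* ny (nonNeg-recip nx (*-inverseʳ x x≢0)))))
      where
      x[1+yx⁻¹]≡x+y : x * (oneQ + y * x ⁻¹) ≡ x + y
      x[1+yx⁻¹]≡x+y = trans (law x y (x ⁻¹)) (trans (cong (λ t → x + y + y * (t - oneQ)) (*-inverseʳ x x≢0)) (law₁ x y))
        where
        law : ∀ x y x⁻ → x * (oneQ + y * x⁻) ≡ x + y + y * (x * x⁻ - oneQ)
        law = solve-∀ ring
        law₁ : ∀ x y → x + y + y * (oneQ - oneQ) ≡ x + y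
        law₁ = solve-∀ ring

    nonNeg-fromℤ : ∀ {n} → + 0 ℤ.≤ n → NonNeg (fromℤQ n)
    nonNeg-fromℤ {n} 0≤n = re-dominant (ι-mono-≤ 0≤n) (subst (_≤ ι n ℚ.* ι n) (sym 0²D≡0) (0≤p*p (ι n)))

    Pos : QD → Set
    Pos x = NonNeg x × x ≢ zeroQ

    pos-* : ∀ {x y} → Pos x → Pos y → Pos (x * y)
    pos-* (nx , x≢0) (ny , y≢0) = nonNeg-* nx ny , λ xy≡0 → y≢0 (*-cancelˡ-zero x≢0 xy≡0)

    pos-+ : ∀ {x y} → Pos x → NonNeg y → Pos (x + y)
    pos-+ {x} {y} (nx , x≢0) ny = nonNeg-+ nx ny , λ x+y≡0 → x≢0 (nonNeg-antisym nx (subst NonNeg (y≡-x x+y≡0) ny))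
      where
      y≡-x : x + y ≡ zeroQ → y ≡ - x
      y≡-x x+y≡0 = trans (law x y) (trans (cong (_- x) x+y≡0) (+-identityˡ (- x)))
        where
        law : ∀ x y → y ≡ x + y - x
        law = solve-∀ ring

    pos-recip : ∀ {x y} → NonNeg x → x * y ≡ oneQ → Pos y
    pos-recip {x} nx xy≡1 = nonNeg-recip nx xy≡1 , λ { refl → case trans (sym xy≡1) (law x) of λ () }
      where
      law : ∀ x → x * zeroQ ≡ zeroQ
      law = solve-∀ ring

    pos-⁻¹ : ∀ {x} → Pos x → Pos (x ⁻¹)
    pos-⁻¹ {x} (nx , x≢0) = pos-recip nx (*-inverseʳ x x≢0)

    pos-cancelˡ : ∀ {x y} → Pos x → Pos (x * y) → Pos y
    pos-cancelˡ {x} {y} px pxy = subst Pos x⁻¹xy≡y (pos-* (pos-⁻¹ px) pxy)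
      where
      x⁻¹xy≡y : x ⁻¹ * (x * y) ≡ y
      x⁻¹xy≡y = trans (law x y (x ⁻¹)) (trans (cong (λ t → y + y * (t - oneQ)) (*-inverseʳ x (proj₂ px))) (law₁ y))
        where
        law : ∀ x y x⁻ → x⁻ * (x * y) ≡ y + y * (x * x⁻ - oneQ)
        law = solve-∀ ring
        law₁ : ∀ y → y + y * (oneQ - oneQ) ≡ y
        law₁ = solve-∀ ring

    trichotomy : ∀ x → Pos x ⊎ x ≡ zeroQ ⊎ Pos (- x)
    trichotomy x with x ≟ zeroQ
    ... | yes x≡0 = inj₂ (inj₁ x≡0)
    ... | no x≢0 = Sum.map (_, x≢0) (λ n-x → inj₂ (n-x , neg-≢0 x≢0)) (nonNeg-total x)

    pos-fromℤ : ∀ {n} → + 0 ℤ.< n → Pos (fromℤQ n)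
    pos-fromℤ {n} 0<n = nonNeg-fromℤ (ℤ.<⇒≤ 0<n) , λ n≡0 → ℤ.<⇒≢ 0<n (sym (ι-injective (cong re n≡0)))

    pos-1 : Pos oneQ
    pos-1 = pos-fromℤ {+ 1} (ℤ.+<+ (ℕ.s≤s ℕ.z≤n))

    1≤⇒pos-fromℤ : ∀ {n} → + 1 ℤ.≤ n → Pos (fromℤQ n)
    1≤⇒pos-fromℤ 1≤n = pos-fromℤ (ℤ.<-≤-trans (ℤ.+<+ (ℕ.s≤s ℕ.z≤n)) 1≤n)

    1≤⇒nonNeg-fromℤ-1 : ∀ {n} → + 1 ℤ.≤ n → NonNeg (fromℤQ n - oneQ)
    1≤⇒nonNeg-fromℤ-1 {n} 1≤n = subst NonNeg (fromℤ-- n (+ 1)) (nonNeg-fromℤ (ℤ.i≤j⇒0≤j-i 1≤n))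

    archimedean : ∀ x → Σ ℕ λ n → NonNeg (fromℤQ (+ n) - x)
    archimedean (a +√ b) with ℚ-archimedean (a ℚ.+ b ℚ.* b ℚ.* Dℚ ℚ.+ 1ℚ)
    ... | n , a+B+1≤n = n , re-dominant 0≤M (subst (_≤ M ℚ.* M) (cong (ℚ._* Dℚ) (sym (law b))) (ℚ.≤-trans B≤M M≤M²))
      where
      law : ∀ b → (0ℚ ℚ.- b) ℚ.* (0ℚ ℚ.- b) ≡ b ℚ.* b
      law = solve-∀ ℚ-ring
      law₁ : ∀ n a B → n ℚ.- (a ℚ.+ B ℚ.+ 1ℚ) ≡ n ℚ.- a ℚ.- (B ℚ.+ 1ℚ)
      law₁ = solve-∀ ℚ-ring
      law₂ : ∀ M B → M ℚ.- (B ℚ.+ 1ℚ) ℚ.+ 1ℚ ≡ M ℚ.- B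
      law₂ = solve-∀ ℚ-ring
      law₃ : ∀ M → M ℚ.* (M ℚ.- 1ℚ) ≡ M ℚ.* M ℚ.- M
      law₃ = solve-∀ ℚ-ring
      law₄ : ∀ M B → M ℚ.- (B ℚ.+ 1ℚ) ℚ.+ B ≡ M ℚ.- 1ℚ
      law₄ = solve-∀ ℚ-ring
      0≤1 : 0ℚ ≤ 1ℚ
      0≤1 = ℚ.*≤* (ℤ.+≤+ ℕ.z≤n)
      B = b ℚ.* b ℚ.* Dℚ
      M = ι (+ n) ℚ.- a
      0≤M-B-1 : 0ℚ ≤ M ℚ.- (B ℚ.+ 1ℚ)
      0≤M-B-1 = subst (0ℚ ≤_) (law₁ (ι (+ n)) a B) (p≤q⇒0≤q-p a+B+1≤n)
      B≤M : B ≤ M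
      B≤M = 0≤q-p⇒p≤q (subst (0ℚ ≤_) (law₂ M B) (ℚ.+-mono-≤ 0≤M-B-1 0≤1))
      0≤M : 0ℚ ≤ M
      0≤M = ℚ.≤-trans (0≤b²D b) B≤M
      M≤M² : M ≤ M ℚ.* M
      M≤M² = 0≤q-p⇒p≤q (subst (0ℚ ≤_) (law₃ M) (0≤p*q 0≤M (subst (0ℚ ≤_) (law₄ M B) (ℚ.+-mono-≤ 0≤M-B-1 (0≤b²D b)))))

    >1⇒pos : ∀ {x} → Pos (x - oneQ) → Pos x
    >1⇒pos {x} x>1 = subst Pos (sym (law x)) (pos-+ x>1 (proj₁ pos-1))
      where
      law : ∀ x → x ≡ x - oneQ + oneQ
      law = solve-∀ ring

    step-frac-pos : ∀ {c x y} → Pos y → Step c x y → Pos (x - fromℤQ c)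
    step-frac-pos (ny , _) (step e) = pos-recip ny e

    step-frac≢0 : ∀ {c x y} → Step c x y → x - fromℤQ c ≢ zeroQ
    step-frac≢0 {c} {x} {y} (step e) x-c≡0 = case trans (sym e) (trans (cong (y *_) x-c≡0) (law y)) of λ ()
      where
      law : ∀ y → y * zeroQ ≡ zeroQ
      law = solve-∀ ring

    step-pos : ∀ {c x y} → + 0 ℤ.≤ c → Pos y → Step c x y → Pos x
    step-pos {c} {x} 0≤c py st = subst Pos (sym (law x (fromℤQ c))) (pos-+ (step-frac-pos py st) (nonNeg-fromℤ 0≤c))
      where
      law : ∀ x c → x ≡ x - c + c
      law = solve-∀ ring

    step->1 : ∀ {c x y} → + 1 ℤ.≤ c → Pos y → Step c x y → Pos (x - oneQ)
    step->1 {c} {x} 1≤c py st =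
      subst Pos (sym (law x (fromℤQ c))) (pos-+ (step-frac-pos py st) (1≤⇒nonNeg-fromℤ-1 1≤c))
      where
      law : ∀ x c → x - oneQ ≡ x - c + (c - oneQ)
      law = solve-∀ ring

    chain-pos : ∀ {L t x} → All (+ 0 ℤ.≤_) L → Pos t → Chain L t x → Pos x
    chain-pos [] pt [] = pt
    chain-pos (0≤c ∷ 0≤L) pt (st ∷ ch) = step-pos 0≤c (chain-pos 0≤L pt ch) st

    chain->1 : ∀ {L t x} → All (+ 1 ℤ.≤_) L → Pos (t - oneQ) → Chain L t x → Pos (x - oneQ)
    chain->1 [] t>1 [] = t>1
    chain->1 (1≤c ∷ 1≤L) t>1 (st ∷ ch) = step->1 1≤c (>1⇒pos (chain->1 1≤L t>1 ch)) st

    step-⁻¹ : ∀ {x} → x ≢ zeroQ → Step (+ 0) x (x ⁻¹)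
    step-⁻¹ {x} x≢0 = step (trans (cong (x ⁻¹ *_) (law x)) (trans (*-comm (x ⁻¹) x) (*-inverseʳ x x≢0)))
      where
      law : ∀ x → x - zeroQ ≡ x
      law = solve-∀ ring

    step-reflect : ∀ {c x y} → Step c x y → x ≢ zeroQ → Step c ((- y) ⁻¹) ((- x) ⁻¹)
    step-reflect {c} {x} {y} st@(step e) x≢0 = step (trans (cong ((- x) ⁻¹ *_) [-y]⁻¹-c≡-x) (trans (*-comm ((- x) ⁻¹) (- x)) (*-inverseʳ (- x) (neg-≢0 x≢0))))
      where
      [-y]⁻¹≡-[x-c] : (- y) ⁻¹ ≡ - (x - fromℤQ c)
      [-y]⁻¹≡-[x-c] = *-inverse-unique (- y) (*-inverseʳ (- y) (neg-≢0 (step⇒≢0 st))) (trans (law y (x - fromℤQ c)) e)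
        where
        law : ∀ y t → - y * - t ≡ y * t
        law = solve-∀ ring
      [-y]⁻¹-c≡-x : (- y) ⁻¹ - fromℤQ c ≡ - x
      [-y]⁻¹-c≡-x = trans (cong (_- fromℤQ c) [-y]⁻¹≡-[x-c]) (law x (fromℤQ c))
        where
        law : ∀ x c → - (x - c) - c ≡ - x
        law = solve-∀ ring

    chain-reflect : ∀ {L t x} → Chain L t x → x ≢ zeroQ → Chain (reverse L) ((- x) ⁻¹) ((- t) ⁻¹)
    chain-reflect [] _ = []
    chain-reflect {c ∷ L} (st ∷ ch) x≢0 =
      subst (λ M → Chain M _ _) (sym (unfold-reverse c L)) (chain-++ (chain-reflect ch (step⇒≢0 st)) (step-reflect st x≢0 ∷ []))

    -- from -x = c + 1/y: x = (-c-1) + (1 - 1/y) = (-c-1) + 1/(1 + 1/(y - 1))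
    step-negate : ∀ {c d x y z} → Step c (- x) y → Step d y z → + 1 ℤ.≤ d → Pos z →
                  Chain ((ℤ.- c ℤ.- + 1) ∷ + 1 ∷ (d ℤ.- + 1) ∷ []) z x
    step-negate {c} {d} {x} {y} {z} st₁@(step e₁) st₂ 1≤d pz = first ∷ second ∷ step-pred st₂ ∷ []
      where
      s = - x - fromℤQ c
      m = oneQ - s
      y>1 : Pos (y - oneQ)
      y>1 = step->1 1≤d pz st₂
      pos-m : Pos m
      pos-m = subst Pos (trans (law y s) (trans (cong (λ t → m + (t - oneQ)) e₁) (law₁ m))) (pos-* y>1 (step-frac-pos (>1⇒pos y>1) st₁))
        where
        law : ∀ y s → (y - oneQ) * s ≡ oneQ - s + (y * s - oneQ)
        law = solve-∀ ring
        law₁ : ∀ m → m + (oneQ - oneQ) ≡ m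
        law₁ = solve-∀ ring
      u = m ⁻¹
      um≡1 : u * m ≡ oneQ
      um≡1 = trans (*-comm u m) (*-inverseʳ m (proj₂ pos-m))
      first : Step (ℤ.- c ℤ.- + 1) x u
      first = step $ trans (cong (λ t → u * (x - t)) (trans (fromℤ-- (ℤ.- c) (+ 1)) (cong (_- oneQ) (fromℤ-neg c)))) (trans (cong (u *_) (law x (fromℤQ c))) um≡1)
        where
        law : ∀ x c → x - (- c - oneQ) ≡ oneQ - (- x - c)
        law = solve-∀ ring
      second : Step (+ 1) u (y - oneQ)
      second = step $ trans (law y u s) (trans (cong₂ (λ a b → oneQ + u * (a - oneQ) + y * (b - oneQ)) e₁ um≡1) (law₁ y u))
        where
        law : ∀ y u s → (y - oneQ) * (u - oneQ) ≡ oneQ + u * (y * s - oneQ) + y * (u * (oneQ - s) - oneQ)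
        law = solve-∀ ring
        law₁ : ∀ y u → oneQ + u * (oneQ - oneQ) + y * (oneQ - oneQ) ≡ oneQ
        law₁ = solve-∀ ring

    step-floor : ∀ {c x y} → Pos (y - oneQ) → Step c x y → LeQ D (fromℤQ c) x × LtQ D x (fromℤQ (c ℤ.+ + 1))
    step-floor {c} {x} {y} y>1 st@(step e) = toNonNegQ (proj₁ x-c>0) , toNonNegQ (proj₁ c+1-x>0) , proj₂ c+1-x>0
      where
      x-c>0 : Pos (x - fromℤQ c)
      x-c>0 = step-frac-pos (>1⇒pos y>1) st
      c+1-x>0 : Pos (fromℤQ (c ℤ.+ + 1) - x)
      c+1-x>0 = subst Pos (sym c+1-x≡[y-1][x-c]) (pos-* y>1 x-c>0)
        where
        c+1-x≡[y-1][x-c] : fromℤQ (c ℤ.+ + 1) - x ≡ (y - oneQ) * (x - fromℤQ c)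
        c+1-x≡[y-1][x-c] = trans (cong (_- x) (fromℤ-+ c (+ 1))) (trans (law x y (fromℤQ c)) (trans (cong (λ t → (y - oneQ) * (x - fromℤQ c) + (oneQ - t)) e) (law₁ x y (fromℤQ c))))
          where
          law : ∀ x y c → c + oneQ - x ≡ (y - oneQ) * (x - c) + (oneQ - y * (x - c))
          law = solve-∀ ring
          law₁ : ∀ x y c → (y - oneQ) * (x - c) + (oneQ - oneQ) ≡ (y - oneQ) * (x - c)
          law₁ = solve-∀ ring

    isCF-intro : ∀ {v s} (X : ℕ → QD) → X 0 ≡ v → (∀ i → Step (s i) (X i) (X (suc i))) → (∀ i → Pos (X (suc i) - oneQ)) → IsCF D v s
    isCF-intro {s = s} X X₀≡v st X>1 = X , X₀≡v , λ i →
      let floor , ceiling = step-floor (X>1 i) (st i) in floor , ceiling , trans (sym (*≡mulQ (X (suc i)) (X i - fromℤQ (s i)))) (Step.equation (st i))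

    isCF-ext : ∀ {v s s′} → (∀ i → s i ≡ s′ i) → IsCF D v s → IsCF D v s′
    isCF-ext {v} {s} {s′} s≗s′ (X , X₀≡v , cf) = X , X₀≡v , λ i →
      subst (λ c → LeQ D (fromℤQ c) (X i) × LtQ D (X i) (fromℤQ (c ℤ.+ + 1)) × mulQ D (X (suc i)) (X i ⊖ fromℤQ c) ≡ oneQ) (s≗s′ i) (cf i)

    isCF-tail : ∀ {v s} → IsCF D v s → Σ QD λ y → Step (s 0) v y × IsCF D y (λ i → s (suc i))
    isCF-tail {v} {s} (X , refl , cf) = X 1 , step (trans (*≡mulQ (X 1) (X 0 - fromℤQ (s 0))) (proj₂ (proj₂ (cf 0)))) , (λ i → X (suc i)) , refl , λ i → cf (suc i)

    isCF-cons : ∀ {c L per v y} → Step c v y → Pos (y - oneQ) → IsCF D y (evp L per) → IsCF D v (evp (c ∷ L) per)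
    isCF-cons {c} {L} {per} {v} {y} st y>1 (X , refl , cf) = X′ , refl , cf′
      where
      X′ : ℕ → QD
      X′ zero = v
      X′ (suc i) = X i
      cf′ : ∀ i → _
      cf′ zero = let floor , ceiling = step-floor y>1 st in floor , ceiling , trans (sym (*≡mulQ y (v - fromℤQ c))) (Step.equation st)
      cf′ (suc i) = cf i

    isCF-split : ∀ L {M per v} → IsCF D v (evp (L ++ M) per) → Σ QD λ y → Chain L y v × IsCF D y (evp M per)
    isCF-split [] cf = _ , [] , cf
    isCF-split (c ∷ L) {M} {per} cf =
      let _ , st , cf′ = isCF-tail {s = evp (c ∷ L ++ M) per} cf
          y , ch , cfy = isCF-split L {M} {per} cf′
      in y , st ∷ ch , cfy

    isCF-mergeGo : ∀ x L {per t v} → Chain (x ∷ L) t v → All (+ 0 ℤ.≤_) L → Maybe.All (+ 0 ℤ.<_) (last L) → Pos (t - oneQ) →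
                   IsCF D t (periodic per) → IsCF D v (evp (mergeGo x L) per)
    isCF-mergeGo x [] (st ∷ []) _ _ t>1 cf = isCF-cons st t>1 cf
    isCF-mergeGo x (+ zero ∷ []) _ _ (just (ℤ.+<+ ())) _ _
    isCF-mergeGo x (+ zero ∷ y ∷ L) (st₁ ∷ st₂ ∷ st₃ ∷ ch) (_ ∷ _ ∷ 0≤L) last>0 t>1 cf =
      isCF-mergeGo (x ℤ.+ y) L (step-merge-zero st₁ st₂ st₃ ∷ ch) 0≤L (last-tail y L last>0) t>1 cf
    isCF-mergeGo x (+ suc n ∷ L) {per} (st ∷ ch@(st₁ ∷ ch₁)) (_ ∷ 0≤L) last>0 t>1 cf =
      isCF-cons {L = mergeGo (+ suc n) L} {per} st (step->1 (ℤ.+≤+ (ℕ.s≤s ℕ.z≤n)) (chain-pos 0≤L (>1⇒pos t>1) ch₁) st₁)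
                (isCF-mergeGo (+ suc n) L ch 0≤L (last-tail (+ suc n) L last>0) t>1 cf)
    isCF-mergeGo x (-[1+ n ] ∷ L) _ (() ∷ _) _ _ _

    chainValue : ∀ {L t x} → Chain L t x → ℕ → QD
    chainValue {x = x} _ zero = x
    chainValue {t = t} [] (suc k) = t
    chainValue (_ ∷ ch) (suc k) = chainValue ch k

    chainValue-step : ∀ d {L t x} (ch : Chain L t x) k → k ℕ.< length L → Step (nthOr d L k) (chainValue ch k) (chainValue ch (suc k))
    chainValue-step d (st ∷ _) zero _ = st
    chainValue-step d (_ ∷ ch) (suc k) (ℕ.s≤s k<n) = chainValue-step d ch k k<n

    chainValue-end : ∀ {L t x} (ch : Chain L t x) → chainValue ch (length L) ≡ t
    chainValue-end [] = refl
    chainValue-end (_ ∷ ch) = chainValue-end ch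

    chainValue->1 : ∀ {L t x} (ch : Chain L t x) → All (+ 1 ℤ.≤_) L → Pos (t - oneQ) → ∀ k → k ℕ.≤ length L → Pos (chainValue ch k - oneQ)
    chainValue->1 ch 1≤L t>1 zero _ = chain->1 1≤L t>1 ch
    chainValue->1 (_ ∷ ch) (_ ∷ 1≤L) t>1 (suc k) (ℕ.s≤s k≤n) = chainValue->1 ch 1≤L t>1 k k≤n

    isCF-periodic : ∀ {L y} → Chain L y y → All (+ 1 ℤ.≤_) L → L ≢ [] → Pos (y - oneQ) → IsCF D y (periodic L)
    isCF-periodic {[]} _ _ []≢[] _ = ⊥-elim ([]≢[] refl)
    isCF-periodic {c ∷ L} {y} ch 1≤cL _ y>1 = isCF-intro X refl steps (λ i → chainValue->1 ch 1≤cL y>1 (suc i % n) (ℕ.<⇒≤ (m%n<n (suc i) n)))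
      where
      n = suc (length L)
      X : ℕ → QD
      X i = chainValue ch (i % n)
      steps : ∀ i → Step (periodic (c ∷ L) i) (X i) (X (suc i))
      steps i with suc-% i (length L)
      ... | inj₁ eq = subst (λ k → Step (periodic (c ∷ L) i) (X i) (chainValue ch k)) (sym eq) (chainValue-step c ch (i % n) (m%n<n i n))
      ... | inj₂ (eq₀ , eqₙ) = subst (Step (periodic (c ∷ L) i) (X i))
                                     (trans (cong (chainValue ch) eqₙ) (trans (chainValue-end ch) (cong (chainValue ch) (sym eq₀))))
                                     (chainValue-step c ch (i % n) (m%n<n i n))

    -- Uniqueness of expansions

    record Quotients (v : QD) (s : ℕ → ℤ) : Set where
      field
        value   : ℕ → QD
        value₀  : value 0 ≡ v
        steps   : ∀ i → Step (s i) (value i) (value (suc i))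
        floor   : ∀ i → NonNeg (value i - fromℤQ (s i))
        ceiling : ∀ i → Pos (fromℤQ (s i) + oneQ - value i)

      value->1 : ∀ i → + 1 ℤ.≤ s i → Pos (value i - oneQ)
      value->1 i 1≤sᵢ = subst Pos (sym (law (value i) (fromℤQ (s i))))
                          (pos-+ (floor i , step-frac≢0 (steps i)) (1≤⇒nonNeg-fromℤ-1 1≤sᵢ))
        where
        law : ∀ x c → x - oneQ ≡ x - c + (c - oneQ)
        law = solve-∀ ring

    quotients : ∀ {v} s → IsCF D v s → Quotients v s
    quotients s (X , X₀≡v , cf) = record
      { value   = X
      ; value₀  = X₀≡v
      ; steps   = λ i → step (trans (*≡mulQ (X (suc i)) (X i - fromℤQ (s i))) (proj₂ (proj₂ (cf i))))
      ; floor   = λ i → fromNonNegQ (X i - fromℤQ (s i)) (proj₁ (cf i))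
      ; ceiling = λ i → subst (λ t → Pos (t - X i)) (fromℤ-+ (s i) (+ 1))
                              (fromNonNegQ (fromℤQ (s i ℤ.+ + 1) - X i) (proj₁ (proj₁ (proj₂ (cf i)))) , proj₂ (proj₁ (proj₂ (cf i))))
      }

    isCF->1 : ∀ {v} s → IsCF D v s → + 1 ℤ.≤ s 0 → Pos (v - oneQ)
    isCF->1 s cf 1≤s₀ = subst (λ t → Pos (t - oneQ)) value₀ (value->1 0 1≤s₀)
      where open Quotients (quotients s cf)

    private
      two : QD
      two = oneQ + oneQ

      nonNeg-two : NonNeg two
      nonNeg-two = nonNeg-+ (proj₁ pos-1) (proj₁ pos-1)

      -- x₁ x₂ = (c₁ - 1) x₂ + (x₂ - 1) + 1 + 1 with c₁ ≥ 1 and x₂ > 1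
      consecutive-≥2 : ∀ {v s} → (∀ i → + 1 ℤ.≤ s (suc i)) → (X : Quotients v s) →
                       ∀ i → let x = Quotients.value X in NonNeg (x (suc i) * x (suc (suc i)) - two)
      consecutive-≥2 {s = s} s≥1 X i = subst NonNeg (sym x₁x₂-2≡) (nonNeg-+ (nonNeg-* c₁-1≥0 (proj₁ (>1⇒pos x₂>1))) (proj₁ x₂>1))
        where
        open Quotients X
        c₁ = fromℤQ (s (suc i))
        x₁ = value (suc i)
        x₂ = value (suc (suc i))
        x₂>1 : Pos (x₂ - oneQ)
        x₂>1 = value->1 (suc (suc i)) (s≥1 (suc i))
        c₁-1≥0 : NonNeg (c₁ - oneQ)
        c₁-1≥0 = 1≤⇒nonNeg-fromℤ-1 (s≥1 i)
        law : ∀ x₁ x₂ c₁ → x₁ * x₂ - (oneQ + oneQ) ≡ (c₁ - oneQ) * x₂ + (x₂ - oneQ) + (x₂ * (x₁ - c₁) - oneQ)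
        law = solve-∀ ring
        law₁ : ∀ x₂ c₁ → (c₁ - oneQ) * x₂ + (x₂ - oneQ) + (oneQ - oneQ) ≡ (c₁ - oneQ) * x₂ + (x₂ - oneQ)
        law₁ = solve-∀ ring
        x₁x₂-2≡ : x₁ * x₂ - two ≡ (c₁ - oneQ) * x₂ + (x₂ - oneQ)
        x₁x₂-2≡ = trans (law x₁ x₂ c₁) (trans (cong (λ t → (c₁ - oneQ) * x₂ + (x₂ - oneQ) + (t - oneQ)) (Step.equation (steps (suc i)))) (law₁ x₂ c₁))

      -- The difference δ of two expansions with the same digits stays in (-1, 1), but δ₂ₖ ≥ (k + 1) δ₀.
      module SameDigits {u v s} (s≥1 : ∀ i → + 1 ℤ.≤ s (suc i)) (U : Quotients u s) (V : Quotients v s) where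
        x y : ℕ → QD
        x = Quotients.value U
        y = Quotients.value V

        δ : ℕ → QD
        δ i = x i - y i

        δ<1 : ∀ i → Pos (oneQ - δ i)
        δ<1 i = subst Pos (sym (law (x i) (y i) (fromℤQ (s i)))) (pos-+ (Quotients.ceiling U i) (Quotients.floor V i))
          where
          law : ∀ x y c → oneQ - (x - y) ≡ c + oneQ - x + (y - c)
          law = solve-∀ ring

        δ-step : ∀ i → δ i * (x (suc i) * y (suc i)) ≡ - δ (suc i)
        δ-step i = trans (law (x i) (y i) (fromℤQ (s i)) (x (suc i)) (y (suc i)))
                         (trans (cong₂ (λ a b → y (suc i) * a - x (suc i) * b) (Step.equation (Quotients.steps U i)) (Step.equation (Quotients.steps V i)))
                                (law₁ (x (suc i)) (y (suc i))))
          where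
          law : ∀ x y c x₁ y₁ → (x - y) * (x₁ * y₁) ≡ y₁ * (x₁ * (x - c)) - x₁ * (y₁ * (y - c))
          law = solve-∀ ring
          law₁ : ∀ x₁ y₁ → y₁ * oneQ - x₁ * oneQ ≡ - (x₁ - y₁)
          law₁ = solve-∀ ring

        G : ℕ → QD
        G i = x (suc i) * y (suc i) * (x (suc (suc i)) * y (suc (suc i)))

        δ-step₂ : ∀ i → δ (suc (suc i)) ≡ δ i * G i
        δ-step₂ i = trans (law (δ i) (δ (suc i)) (δ (suc (suc i))) a b)
                          (trans (cong₂ (λ p q → δ i * (a * b) + (p + δ (suc (suc i))) - b * (q + δ (suc i))) (δ-step (suc i)) (δ-step i))
                                 (law₁ (δ i) (δ (suc i)) (δ (suc (suc i))) a b))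
          where
          a = x (suc i) * y (suc i)
          b = x (suc (suc i)) * y (suc (suc i))
          law : ∀ d₀ d₁ d₂ a b → d₂ ≡ d₀ * (a * b) + (d₁ * b + d₂) - b * (d₀ * a + d₁)
          law = solve-∀ ring
          law₁ : ∀ d₀ d₁ d₂ a b → d₀ * (a * b) + (- d₂ + d₂) - b * (- d₁ + d₁) ≡ d₀ * (a * b)
          law₁ = solve-∀ ring

        G≥2 : ∀ i → NonNeg (G i - two)
        G≥2 i = subst NonNeg (sym (law (x (suc i)) (x (suc (suc i))) (y (suc i)) (y (suc (suc i)))))
                  (nonNeg-+ (nonNeg-+ (nonNeg-+ (nonNeg-* Px Py) (nonNeg-* nonNeg-two Px)) (nonNeg-* nonNeg-two Py)) nonNeg-two)
          where
          Px : NonNeg (x (suc i) * x (suc (suc i)) - two)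
          Px = consecutive-≥2 s≥1 U i
          Py : NonNeg (y (suc i) * y (suc (suc i)) - two)
          Py = consecutive-≥2 s≥1 V i
          law : ∀ x₁ x₂ y₁ y₂ → x₁ * y₁ * (x₂ * y₂) - (oneQ + oneQ)
                ≡ (x₁ * x₂ - (oneQ + oneQ)) * (y₁ * y₂ - (oneQ + oneQ)) + (oneQ + oneQ) * (x₁ * x₂ - (oneQ + oneQ))
                  + (oneQ + oneQ) * (y₁ * y₂ - (oneQ + oneQ)) + (oneQ + oneQ)
          law = solve-∀ ring

        even : ℕ → ℕ
        even zero = zero
        even (suc k) = suc (suc (even k))

        growth : Pos (δ 0) → ∀ k → NonNeg (δ (even k) - (fromℤQ (+ k) + oneQ) * δ 0)
        growth (nδ₀ , _) zero = subst NonNeg (sym (law (δ 0))) (nonNeg-fromℤ {+ 0} (ℤ.+≤+ ℕ.z≤n))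
          where
          law : ∀ d → d - (zeroQ + oneQ) * d ≡ zeroQ
          law = solve-∀ ring
        growth pδ₀@(nδ₀ , _) (suc k) = subst NonNeg (sym eq)
          (nonNeg-+ (nonNeg-* (growth pδ₀ k) nG) (nonNeg-* nδ₀ (nonNeg-+ (nonNeg-* (nonNeg-+ nN (proj₁ pos-1)) (G≥2 (even k))) nN)))
          where
          N = fromℤQ (+ k)
          nN : NonNeg N
          nN = nonNeg-fromℤ {+ k} (ℤ.+≤+ ℕ.z≤n)
          nG : NonNeg (G (even k))
          nG = subst NonNeg (sym (law₀ (G (even k)))) (nonNeg-+ (G≥2 (even k)) nonNeg-two)
            where
            law₀ : ∀ g → g ≡ g - two + two
            law₀ = solve-∀ ring
          law : ∀ d g d₀ N → d * g - (oneQ + N + oneQ) * d₀ ≡ (d - (N + oneQ) * d₀) * g + d₀ * ((N + oneQ) * (g - (oneQ + oneQ)) + N)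
          law = solve-∀ ring
          eq : δ (even (suc k)) - (fromℤQ (+ suc k) + oneQ) * δ 0 ≡ (δ (even k) - (N + oneQ) * δ 0) * G (even k) + δ 0 * ((N + oneQ) * (G (even k) - two) + N)
          eq = trans (cong₂ (λ a b → a - (b + oneQ) * δ 0) (δ-step₂ (even k)) (fromℤ-+ (+ 1) (+ k))) (law (δ (even k)) (G (even k)) (δ 0) N)

        δ₀≯0 : ¬ Pos (δ 0)
        δ₀≯0 pδ₀@(nδ₀ , δ₀≢0) = proj₂ d>1 (nonNeg-antisym (proj₁ d>1) (subst NonNeg (law₂ d) (proj₁ (δ<1 (even n)))))
          where
          n = proj₁ (archimedean (δ 0 ⁻¹))
          N = fromℤQ (+ n)
          d = δ (even n)
          law : ∀ d d₀ d₀⁻ N → d₀ + ((d - (N + oneQ) * d₀) + (N - d₀⁻) * d₀) ≡ d - d₀⁻ * d₀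
          law = solve-∀ ring
          law₂ : ∀ d → oneQ - d ≡ - (d - oneQ)
          law₂ = solve-∀ ring
          d>1 : Pos (d - oneQ)
          d>1 = subst Pos (trans (law d (δ 0) (δ 0 ⁻¹) N) (cong (λ t → d - t) (trans (*-comm (δ 0 ⁻¹) (δ 0)) (*-inverseʳ (δ 0) δ₀≢0))))
                  (pos-+ pδ₀ (nonNeg-+ (growth pδ₀ n) (nonNeg-* (proj₂ (archimedean (δ 0 ⁻¹))) nδ₀)))

        u≯v : ¬ Pos (u - v)
        u≯v = subst (λ t → ¬ Pos t) (cong₂ _-_ (Quotients.value₀ U) (Quotients.value₀ V)) δ₀≯0

    isCF-unique : ∀ {u v} s → (∀ i → + 1 ℤ.≤ s (suc i)) → IsCF D u s → IsCF D v s → u ≡ v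
    isCF-unique {u} {v} s s≥1 cfu cfv with trichotomy (u - v)
    ... | inj₁ u>v = ⊥-elim (SameDigits.u≯v s≥1 (quotients s cfu) (quotients s cfv) u>v)
    ... | inj₂ (inj₁ u-v≡0) = trans (law u v) (trans (cong (_+ v) u-v≡0) (+-identityˡ v))
      where
      law : ∀ u v → u ≡ u - v + v
      law = solve-∀ ring
    ... | inj₂ (inj₂ v>u) = ⊥-elim (SameDigits.u≯v s≥1 (quotients s cfv) (quotients s cfu) (subst Pos (law u v) v>u))
      where
      law : ∀ u v → - (u - v) ≡ v - u
      law = solve-∀ ring

    -- Galois' theorem on purely periodic expansions

    record PositiveMatrix (M : Matrix) : Set where
      field
        p>0 : Pos (Matrix.p M)
        p′>0 : Pos (Matrix.p′ M)
        q>0 : Pos (Matrix.q M)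
        q′≥0 : NonNeg (Matrix.q′ M)
        p≥p′ : NonNeg (Matrix.p M - Matrix.p′ M)
        q≥q′ : NonNeg (Matrix.q M - Matrix.q′ M)
        p+q>p′+q′ : Pos (Matrix.p M + Matrix.q M - (Matrix.p′ M + Matrix.q′ M))

    convergents-[c]-positive : ∀ {c} → + 1 ℤ.≤ c → PositiveMatrix (convergents (c ∷ []))
    convergents-[c]-positive {c} 1≤c = record
      { p>0 = subst Pos (sym (law₁ C)) (1≤⇒pos-fromℤ 1≤c)
      ; p′>0 = subst Pos (sym (law₂ C)) pos-1
      ; q>0 = pos-1
      ; q′≥0 = nonNeg-fromℤ {+ 0} (ℤ.+≤+ ℕ.z≤n)
      ; p≥p′ = subst NonNeg (sym (law₃ C)) (1≤⇒nonNeg-fromℤ-1 1≤c)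
      ; q≥q′ = subst NonNeg (sym (law₄ oneQ)) (proj₁ pos-1)
      ; p+q>p′+q′ = subst Pos (sym (law₅ C)) (1≤⇒pos-fromℤ 1≤c)
      }
      where
      C = fromℤQ c
      law₁ : ∀ C → C * oneQ + zeroQ ≡ C
      law₁ = solve-∀ ring
      law₂ : ∀ C → C * zeroQ + oneQ ≡ oneQ
      law₂ = solve-∀ ring
      law₃ : ∀ C → C * oneQ + zeroQ - (C * zeroQ + oneQ) ≡ C - oneQ
      law₃ = solve-∀ ring
      law₄ : ∀ t → t - zeroQ ≡ t
      law₄ = solve-∀ ring
      law₅ : ∀ C → C * oneQ + zeroQ + oneQ - (C * zeroQ + oneQ + zeroQ) ≡ C
      law₅ = solve-∀ ring

    convergents-∷-positive : ∀ {c L} → + 1 ℤ.≤ c → PositiveMatrix (convergents L) → PositiveMatrix (convergents (c ∷ L))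
    convergents-∷-positive {c} {L} 1≤c M>0 = record
      { p>0 = subst Pos (+-comm q (C * p)) (pos-+ q>0 (nonNeg-* nC (proj₁ p>0)))
      ; p′>0 = pos-+ (pos-* (1≤⇒pos-fromℤ 1≤c) p′>0) q′≥0
      ; q>0 = p>0
      ; q′≥0 = proj₁ p′>0
      ; p≥p′ = subst NonNeg (sym (law C p p′ q q′)) (nonNeg-+ (nonNeg-* nC p≥p′) q≥q′)
      ; q≥q′ = p≥p′
      ; p+q>p′+q′ = subst Pos (sym (law₁ C p p′ q q′)) (pos-+ p+q>p′+q′ (nonNeg-* nC p≥p′))
      }
      where
      open Matrix (convergents L)
      open PositiveMatrix M>0
      C = fromℤQ c
      nC = proj₁ (1≤⇒pos-fromℤ 1≤c)
      law : ∀ C p p′ q q′ → C * p + q - (C * p′ + q′) ≡ C * (p - p′) + (q - q′)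
      law = solve-∀ ring
      law₁ : ∀ C p p′ q q′ → C * p + q + p - (C * p′ + q′ + p′) ≡ p + q - (p′ + q′) + C * (p - p′)
      law₁ = solve-∀ ring

    convergents-positive : ∀ c L → All (+ 1 ℤ.≤_) (c ∷ L) → PositiveMatrix (convergents (c ∷ L))
    convergents-positive c [] (1≤c ∷ []) = convergents-[c]-positive {c} 1≤c
    convergents-positive c (d ∷ L) (1≤c ∷ 1≤dL) = convergents-∷-positive {c} {d ∷ L} 1≤c (convergents-positive d L 1≤dL)

    vieta : ∀ {p p′ q q′ y z} → y ≢ z → y * (q * y + q′) ≡ p * y + p′ → z * (q * z + q′) ≡ p * z + p′ →
            q * y * - z ≡ p′ × q * (y + oneQ) * (z + oneQ) ≡ p + q - (p′ + q′)
    vieta {p} {p′} {q} {q′} {y} {z} y≢z fy fz = qy[-z]≡p′ , q[y+1][z+1]≡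
      where
      S≡0 : q * (y + z) + q′ - p ≡ zeroQ
      S≡0 = *-cancelˡ-zero {y - z} (λ y-z≡0 → y≢z (trans (law₀ y z) (trans (cong (_+ z) y-z≡0) (+-identityˡ z))))
              (trans (law y z p p′ q q′) (trans (cong₂ (λ a b → a - (p * y + p′) - (b - (p * z + p′))) fy fz) (law₁ (p * y + p′) (p * z + p′))))
        where
        law₀ : ∀ y z → y ≡ y - z + z
        law₀ = solve-∀ ring
        law : ∀ y z p p′ q q′ → (y - z) * (q * (y + z) + q′ - p) ≡ y * (q * y + q′) - (p * y + p′) - (z * (q * z + q′) - (p * z + p′))
        law = solve-∀ ring
        law₁ : ∀ a b → a - a - (b - b) ≡ zeroQ
        law₁ = solve-∀ ring
      qy[-z]≡p′ : q * y * - z ≡ p′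
      qy[-z]≡p′ = trans (law y z p p′ q q′) (trans (cong₂ (λ a b → p′ + (a - (p * y + p′)) - y * b) fy S≡0) (law₁ p′ (p * y + p′) y))
        where
        law : ∀ y z p p′ q q′ → q * y * - z ≡ p′ + (y * (q * y + q′) - (p * y + p′)) - y * (q * (y + z) + q′ - p)
        law = solve-∀ ring
        law₁ : ∀ p′ a y → p′ + (a - a) - y * zeroQ ≡ p′
        law₁ = solve-∀ ring
      q[y+1][z+1]≡ : q * (y + oneQ) * (z + oneQ) ≡ p + q - (p′ + q′)
      q[y+1][z+1]≡ = trans (law y z p p′ q q′) (trans (cong₂ (λ a b → p + q - (p′ + q′) + b + y * b - (a - (p * y + p′))) fy S≡0) (law₁ (p + q - (p′ + q′)) (p * y + p′) y))
        where
        law : ∀ y z p p′ q q′ → q * (y + oneQ) * (z + oneQ)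
              ≡ p + q - (p′ + q′) + (q * (y + z) + q′ - p) + y * (q * (y + z) + q′ - p) - (y * (q * y + q′) - (p * y + p′))
        law = solve-∀ ring
        law₁ : ∀ d a y → d + zeroQ + y * zeroQ - (a - a) ≡ d
        law₁ = solve-∀ ring

    -- y and ȳ are both fixed points of the Möbius map of the period.
    galois : ∀ {L y} → Chain L y y → All (+ 1 ℤ.≤_) L → L ≢ [] → Pos (y - oneQ) → conjQ y ≢ y →
             Pos (- conjQ y) × Pos (conjQ y + oneQ)
    galois {[]} _ _ []≢[] = ⊥-elim ([]≢[] refl)
    galois {c ∷ L} {y} ch 1≤cL _ y>1 ȳ≢y =
      pos-cancelˡ (pos-* q>0 py) (subst Pos (sym (proj₁ roots)) p′>0) ,
      pos-cancelˡ (pos-* q>0 (pos-+ py (proj₁ pos-1))) (subst Pos (sym (proj₂ roots)) p+q>p′+q′)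
      where
      open Matrix (convergents (c ∷ L))
      open PositiveMatrix (convergents-positive c L 1≤cL)
      py : Pos y
      py = >1⇒pos y>1
      roots : q * y * - conjQ y ≡ p′ × q * (y + oneQ) * (conjQ y + oneQ) ≡ p + q - (p′ + q′)
      roots = vieta {p} {p′} {q} {q′} (ȳ≢y ∘ sym) (chain-möbius ch) (chain-möbius (conj-chain ch))

    reflect->1 : ∀ {z} → Pos (- z) → Pos (z + oneQ) → Pos ((- z) ⁻¹ - oneQ)
    reflect->1 {z} p-z z+1>0 = subst Pos (sym w-1≡w[z+1]) (pos-* (pos-⁻¹ p-z) z+1>0)
      where
      w = (- z) ⁻¹
      law : ∀ w z → w - oneQ ≡ w * (z + oneQ) + (w * - z - oneQ)
      law = solve-∀ ring
      law₁ : ∀ w z → w * (z + oneQ) + (oneQ - oneQ) ≡ w * (z + oneQ)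
      law₁ = solve-∀ ring
      w-1≡w[z+1] : w - oneQ ≡ w * (z + oneQ)
      w-1≡w[z+1] = trans (law w z) (trans (cong (λ t → w * (z + oneQ) + (t - oneQ)) (trans (*-comm w (- z)) (*-inverseʳ (- z) (proj₂ p-z)))) (law₁ w z))

    record EventuallyPeriodic (v : QD) (pre per : List ℤ) : Set where
      field
        tail : QD
        chain : Chain (pre ++ per) tail v
        tail>1 : Pos (tail - oneQ)
        tail-periodic : IsCF D tail (periodic per)

    isCF-cfSeq : ∀ {v x L per} → EventuallyPeriodic v (x ∷ L) per → All (+ 0 ℤ.≤_) L → All (+ 0 ℤ.<_) per → per ≢ [] →
                 IsCF D v (cfSeq (x ∷ L) per)
    isCF-cfSeq {x = x} {L} {per} e 0≤L per>0 per≢[] =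
      isCF-mergeGo x (L ++ per) chain (++⁺ 0≤L (All.map ℤ.<⇒≤ per>0))
                   (subst (Maybe.All (+ 0 ℤ.<_)) (sym (last-++ L per≢[])) (last-All per per>0)) tail>1 tail-periodic
      where open EventuallyPeriodic e

    purely-periodic : ∀ {y per} → IsCF D y (periodic per) → All (+ 0 ℤ.<_) per → per ≢ [] → Chain per y y × Pos (y - oneQ)
    purely-periodic {y} {per} cf per>0 per≢[] = subst (λ t → Chain per t y) y′≡y (proj₁ (proj₂ split)) , isCF->1 (periodic per) cf (digits≥1 0)
      where
      digits≥1 : ∀ i → + 1 ℤ.≤ periodic per i
      digits≥1 = periodic-All (All.map pos⇒1≤ per>0) per≢[]
      split = isCF-split per {[]} {per} (subst (λ M → IsCF D y (evp M per)) (sym (++-identityʳ per)) (isCF-ext (periodic-unfold per) cf))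
      y′≡y : proj₁ split ≡ y
      y′≡y = isCF-unique (periodic per) (λ i → digits≥1 (suc i)) (proj₂ (proj₂ split)) cf

    isCF-preperiod : ∀ {w} pre {per} → IsCF D w (evp pre per) → Σ QD λ y → Chain pre y w × IsCF D y (periodic per)
    isCF-preperiod {w} pre {per} cf = isCF-split pre {[]} {per} (subst (λ M → IsCF D w (evp M per)) (sym (++-identityʳ pre)) cf)

    singleton-step : ∀ {c t x} → Chain (c ∷ []) t x → Step c x t
    singleton-step (st ∷ []) = st

    eventuallyPeriodic : ∀ {pre per t v} → Chain pre t v → Chain per t t → All (+ 1 ℤ.≤_) per → per ≢ [] → Pos (t - oneQ) →
                         EventuallyPeriodic v pre per
    eventuallyPeriodic ch-pre ch-per 1≤per per≢[] t>1 =
      record { chain = chain-++ ch-pre ch-per ; tail>1 = t>1 ; tail-periodic = isCF-periodic ch-per 1≤per per≢[] t>1 }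

module ConjugateExpansion {D : ℕ} (nonSquare : NonSquare D)
                          {as p q} (as>0 : All (+ 0 ℤ.<_) as) (p>0 : + 0 ℤ.< p) (q>0 : + 0 ℤ.< q) where
  open QuadraticField D
  open Field nonSquare

  period period₁ period₂ : List ℤ
  period = as ++ p ∷ q ∷ []
  period₁ = p ∷ reverse as ++ q ∷ []
  period₂ = reverse as ++ q ∷ p ∷ []

  1≤as : All (+ 1 ℤ.≤_) as
  1≤as = All.map pos⇒1≤ as>0

  1≤period : All (+ 1 ℤ.≤_) period
  1≤period = ++⁺ 1≤as (pos⇒1≤ p>0 ∷ pos⇒1≤ q>0 ∷ [])

  1≤period₁ : All (+ 1 ℤ.≤_) period₁
  1≤period₁ = pos⇒1≤ p>0 ∷ ++⁺ (All-reverse 1≤as) (pos⇒1≤ q>0 ∷ [])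

  1≤period₂ : All (+ 1 ℤ.≤_) period₂
  1≤period₂ = ++⁺ (All-reverse 1≤as) (pos⇒1≤ q>0 ∷ pos⇒1≤ p>0 ∷ [])

  -- z is the conjugate of a purely periodic y = [period, y]; reading the conjugated
  -- period backwards gives w₀ = -1/z = [q, p, reverse as, w₀].
  record Reversal (z : QD) : Set where
    field
      w₀ w₁ w₂ : QD
      w₀-step : Step (+ 0) (- z) w₀
      q-step : Step q w₀ w₁
      p-step : Step p w₁ w₂
      w₁>1 : Pos (w₁ - oneQ)
      w₂>1 : Pos (w₂ - oneQ)
      expansion₁ : ∀ {pre v} → Chain pre w₁ v → EventuallyPeriodic v pre period₁
      expansion₂ : ∀ {pre v} → Chain pre w₂ v → EventuallyPeriodic v pre period₂

  reversal : ∀ {y} → Chain period y y → Pos (y - oneQ) → conjQ y ≢ y → Reversal (conjQ y)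
  reversal {y} ch y>1 ȳ≢y with subst (λ L → Chain L _ _) (reverse-++ as (p ∷ q ∷ [])) (chain-reflect (conj-chain ch) (conj-≢0 ȳ≢y))
  ... | q-step ∷ p-step ∷ ch-as = record
    { w₀-step = step-⁻¹ (proj₂ (proj₁ ȳ∈⟨-1,0⟩))
    ; q-step = q-step
    ; p-step = p-step
    ; w₁>1 = w₁>1
    ; w₂>1 = w₂>1
    ; expansion₁ = λ ch-pre → eventuallyPeriodic ch-pre (p-step ∷ chain-++ ch-as (q-step ∷ [])) 1≤period₁ (λ ()) w₁>1
    ; expansion₂ = λ ch-pre → eventuallyPeriodic ch-pre (chain-++ ch-as (q-step ∷ p-step ∷ [])) 1≤period₂ (++-∷-≢[] (reverse as)) w₂>1
    }
    where
    ȳ∈⟨-1,0⟩ : Pos (- conjQ y) × Pos (conjQ y + oneQ)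
    ȳ∈⟨-1,0⟩ = galois ch 1≤period (++-∷-≢[] as) y>1 ȳ≢y
    w₀>1 : Pos ((- conjQ y) ⁻¹ - oneQ)
    w₀>1 = reflect->1 (proj₁ ȳ∈⟨-1,0⟩) (proj₂ ȳ∈⟨-1,0⟩)
    w₁>1 = chain->1 (pos⇒1≤ p>0 ∷ All-reverse 1≤as) w₀>1 (p-step ∷ ch-as)
    w₂>1 = chain->1 (All-reverse 1≤as) w₀>1 ch-as

  conj-tail : ∀ {w} pre → conjQ w ≢ w → IsCF D w (evp pre period) → Σ QD λ y → Chain pre y w × Reversal (conjQ y)
  conj-tail pre w̄≢w cf = y , ch-pre , reversal (proj₁ cycle) (proj₂ cycle) (chain-irrational ch-pre w̄≢w)
    where
    y = proj₁ (isCF-preperiod pre cf)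
    ch-pre = proj₁ (proj₂ (isCF-preperiod pre cf))
    cycle = purely-periodic (proj₂ (proj₂ (isCF-preperiod pre cf))) (++⁺ as>0 (p>0 ∷ q>0 ∷ [])) (++-∷-≢[] as)

  conj-expansion : ∀ {w} pre → conjQ w ≢ w → IsCF D w (evp pre period) →
                   EventuallyPeriodic (conjQ w) (pre ++ -[1+ 0 ] ∷ + 1 ∷ (q ℤ.- + 1) ∷ []) period₁
  conj-expansion pre w̄≢w cf = expansion₁ (chain-++ (conj-chain (proj₁ (proj₂ tail))) negated)
    where
    tail = conj-tail pre w̄≢w cf
    open Reversal (proj₂ (proj₂ tail))
    negated : Chain (-[1+ 0 ] ∷ + 1 ∷ (q ℤ.- + 1) ∷ []) w₁ (conjQ (proj₁ tail))
    negated = step-negate w₀-step q-step (pos⇒1≤ q>0) (>1⇒pos w₁>1)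

  conj-last-digit : ∀ {w} ks k → conjQ w ≢ w → IsCF D w (evp (ks ++ k ∷ []) period) →
                    EventuallyPeriodic (conjQ w) (ks ++ (k ℤ.- q ℤ.- + 1) ∷ + 1 ∷ (p ℤ.- + 1) ∷ []) period₂
  conj-last-digit ks k w̄≢w cf = expansion₂ (chain-++ (conj-chain ch-ks) (subst (λ c → Chain (c ∷ _) w₂ (conjQ x)) (law k q) negated))
    where
    tail = conj-tail (ks ++ k ∷ []) w̄≢w cf
    open Reversal (proj₂ (proj₂ tail))
    split = chain-split ks (proj₁ (proj₂ tail))
    x = proj₁ split
    ch-ks = proj₁ (proj₂ split)
    negated : Chain ((ℤ.- (q ℤ.- k) ℤ.- + 1) ∷ + 1 ∷ (p ℤ.- + 1) ∷ []) w₂ (conjQ x)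
    negated = step-negate (step-flip (conj-step (singleton-step (proj₂ (proj₂ split)))) w₀-step q-step) p-step (pos⇒1≤ p>0) (>1⇒pos w₂>1)
    law : ∀ k q → ℤ.- (q ℤ.- k) ℤ.- + 1 ≡ k ℤ.- q ℤ.- + 1
    law = ℤ-solve-∀

  conj-last-two-digits : ∀ {w} ks u k → k ℤ.< q → conjQ w ≢ w → IsCF D w (evp (ks ++ u ∷ k ∷ []) period) →
                         EventuallyPeriodic (conjQ w) (ks ++ (u ℤ.- + 1) ∷ + 1 ∷ (q ℤ.- k ℤ.- + 1) ∷ []) period₁
  conj-last-two-digits ks u k k<q w̄≢w cf = expansion₁ (chain-++ (conj-chain ch-ks) (subst (λ c → Chain (c ∷ _) w₁ (conjQ x₂)) (law u) negated))
    where
    tail = conj-tail (ks ++ u ∷ k ∷ []) w̄≢w cf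
    open Reversal (proj₂ (proj₂ tail))
    split = chain-split ks (proj₁ (proj₂ tail))
    x₂ = proj₁ split
    ch-ks = proj₁ (proj₂ split)
    last-two = chain-split (u ∷ []) (proj₂ (proj₂ split))
    negated : Chain ((ℤ.- (ℤ.- u) ℤ.- + 1) ∷ + 1 ∷ (q ℤ.- k ℤ.- + 1) ∷ []) w₁ (conjQ x₂)
    negated = step-negate (step-neg (conj-step (singleton-step (proj₁ (proj₂ last-two)))))
                          (step-flip (conj-step (singleton-step (proj₂ (proj₂ last-two)))) w₀-step q-step) (<⇒1≤- k<q) (>1⇒pos w₁>1)
    law : ∀ u → ℤ.- (ℤ.- u) ℤ.- + 1 ≡ u ℤ.- + 1
    law = ℤ-solve-∀

  private
    0≤1 : + 0 ℤ.≤ + 1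
    0≤1 = ℤ.+≤+ ℕ.z≤n

    0≤[n-1] : ∀ {n} → + 0 ℤ.< n → + 0 ℤ.≤ n ℤ.- + 1
    0≤[n-1] = ℤ.i≤j⇒0≤j-i ∘ pos⇒1≤

    period₁>0 : All (+ 0 ℤ.<_) period₁
    period₁>0 = p>0 ∷ ++⁺ (All-reverse as>0) (q>0 ∷ [])

    period₂>0 : All (+ 0 ℤ.<_) period₂
    period₂>0 = ++⁺ (All-reverse as>0) (q>0 ∷ p>0 ∷ [])

  isCF-conj-r≡0 : ∀ {w} → conjQ w ≢ w → IsCF D w (periodic period) →
                  IsCF D (conjQ w) (cfSeq (-[1+ 0 ] ∷ + 1 ∷ (q ℤ.- + 1) ∷ []) period₁)
  isCF-conj-r≡0 w̄≢w cf = isCF-cfSeq (conj-expansion [] w̄≢w cf) (0≤1 ∷ 0≤[n-1] q>0 ∷ []) period₁>0 (λ ())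

  isCF-conj-r≡1 : ∀ {w} → conjQ w ≢ w → ∀ k₀ → IsCF D w (evp (k₀ ∷ []) period) →
                  IsCF D (conjQ w) (cfSeq ((k₀ ℤ.- q ℤ.- + 1) ∷ + 1 ∷ (p ℤ.- + 1) ∷ []) period₂)
  isCF-conj-r≡1 w̄≢w k₀ cf = isCF-cfSeq (conj-last-digit [] k₀ w̄≢w cf) (0≤1 ∷ 0≤[n-1] p>0 ∷ []) period₂>0 (++-∷-≢[] (reverse as))

  isCF-conj-r≥2-k>q : ∀ {w k₀ ks} → conjQ w ≢ w → ∀ ks₂ k → 1 ℕ.≤ length ks → All (+ 0 ℤ.<_) ks → k₀ ∷ ks ≡ ks₂ ++ k ∷ [] →
                      q ℤ.< k → IsCF D w (evp (k₀ ∷ ks) period) →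
                      IsCF D (conjQ w) (cfSeq (ks₂ ++ (k ℤ.- q ℤ.- + 1) ∷ + 1 ∷ (p ℤ.- + 1) ∷ []) period₂)
  isCF-conj-r≥2-k>q w̄≢w [] k () _ refl
  isCF-conj-r≥2-k>q w̄≢w (k₀ ∷ ks₂) k _ ks>0 refl q<k cf =
    isCF-cfSeq (conj-last-digit (k₀ ∷ ks₂) k w̄≢w cf) (++⁺ (All.map ℤ.<⇒≤ (++⁻ˡ ks₂ ks>0)) (<⇒0≤-1 q<k ∷ 0≤1 ∷ 0≤[n-1] p>0 ∷ []))
               period₂>0 (++-∷-≢[] (reverse as))

  isCF-conj-r≥2-k<q : ∀ {w k₀ ks} → conjQ w ≢ w → ∀ ks₃ u k → All (+ 0 ℤ.<_) ks → k₀ ∷ ks ≡ ks₃ ++ u ∷ k ∷ [] →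
                      k ℤ.< q → IsCF D w (evp (k₀ ∷ ks) period) →
                      IsCF D (conjQ w) (cfSeq (ks₃ ++ (u ℤ.- + 1) ∷ + 1 ∷ (q ℤ.- k ℤ.- + 1) ∷ []) period₁)
  isCF-conj-r≥2-k<q w̄≢w [] u k _ refl k<q cf =
    isCF-cfSeq (conj-last-two-digits [] u k k<q w̄≢w cf) (0≤1 ∷ <⇒0≤-1 k<q ∷ []) period₁>0 (λ ())
  isCF-conj-r≥2-k<q w̄≢w (k₀ ∷ ks₃) u k ks>0 refl k<q cf with ++⁻ʳ ks₃ ks>0
  ... | u>0 ∷ _ = isCF-cfSeq (conj-last-two-digits (k₀ ∷ ks₃) u k k<q w̄≢w cf)
                             (++⁺ (All.map ℤ.<⇒≤ (++⁻ˡ ks₃ ks>0)) (0≤[n-1] u>0 ∷ 0≤1 ∷ <⇒0≤-1 k<q ∷ [])) period₁>0 (λ ())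


propositionA4 : ∀ (D : ℕ) → NonSquare D → (w : QD) → ¬ (im w ≡ 0ℚ) →
    ∀ (m : ℕ) (as₀ : List ℤ) (p q : ℤ) →
    length as₀ ≡ 2 ℕ.* m → All (λ x → + 0 ℤ.< x) as₀ → + 0 ℤ.< p → + 0 ℤ.< q →
    -- r = 0
    (IsCF D w (evp [] (as₀ ++ p ∷ q ∷ [])) →
      IsCF D (conjQ w)
        (cfSeq (-[1+ 0 ] ∷ + 1 ∷ (q ℤ.- + 1) ∷ []) (p ∷ reverse as₀ ++ q ∷ [])))
    -- r = 1
    × (∀ (k₀ : ℤ) → ¬ (k₀ ≡ q) →
        IsCF D w (evp (k₀ ∷ []) (as₀ ++ p ∷ q ∷ [])) →
        IsCF D (conjQ w)
          (cfSeq ((k₀ ℤ.- q ℤ.- + 1) ∷ + 1 ∷ (p ℤ.- + 1) ∷ []) (reverse as₀ ++ q ∷ p ∷ [])))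
    -- r ≥ 2 , k_{r-1} > a_{2n-1}
    × (∀ (k₀ : ℤ) (ks ks₂ : List ℤ) (kl : ℤ) →
        1 ℕ.≤ length ks → All (λ x → + 0 ℤ.< x) ks →
        k₀ ∷ ks ≡ ks₂ ++ kl ∷ [] → q ℤ.< kl →
        IsCF D w (evp (k₀ ∷ ks) (as₀ ++ p ∷ q ∷ [])) →
        IsCF D (conjQ w)
          (cfSeq (ks₂ ++ (kl ℤ.- q ℤ.- + 1) ∷ + 1 ∷ (p ℤ.- + 1) ∷ []) (reverse as₀ ++ q ∷ p ∷ [])))
    -- r ≥ 2 , 0 < k_{r-1} < a_{2n-1}
    × (∀ (k₀ : ℤ) (ks ks₃ : List ℤ) (u kl : ℤ) →
        1 ℕ.≤ length ks → All (λ x → + 0 ℤ.< x) ks →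
        k₀ ∷ ks ≡ ks₃ ++ u ∷ kl ∷ [] → + 0 ℤ.< kl → kl ℤ.< q →
        IsCF D w (evp (k₀ ∷ ks) (as₀ ++ p ∷ q ∷ [])) →
        IsCF D (conjQ w)
          (cfSeq (ks₃ ++ (u ℤ.- + 1) ∷ + 1 ∷ (q ℤ.- kl ℤ.- + 1) ∷ []) (p ∷ reverse as₀ ++ q ∷ [])))
propositionA4 D nonSquare w im≢0 _ as p q _ as>0 p>0 q>0 =
    isCF-conj-r≡0 w̄≢w
  , (λ k₀ _ → isCF-conj-r≡1 w̄≢w k₀)
  , (λ _ _ → isCF-conj-r≥2-k>q w̄≢w)
  , (λ _ _ ks₃ u k _ ks>0 eq _ → isCF-conj-r≥2-k<q w̄≢w ks₃ u k ks>0 eq)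
  where
  open QuadraticField D
  open Field nonSquare
  open ConjugateExpansion nonSquare as>0 p>0 q>0
  w̄≢w : conjQ w ≢ w
  w̄≢w = im≢0 ∘ conj-fixed⇒im≡0 w
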